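{- For every integer $n\ge 0$, let $\overline p(n)$ be the number of overpartitions of $n$. Then \[ \overline p(n)=(-1)^n\sum_{\substack{c\in\mathcal C_{P_4}\\ |c|=n}}(-2)^{\ell(c)}, \] where $P_4=\{m^2: m\in\mathbb N\}$ is the set of positive perfect squares.
   Context: An overpartition of $n$ is a partition of $n$ (unordered sum of positive integers) in which the first occurrence of each distinct part value may or may not be overlined; $\overline p(0)=1$. Equivalently $\sum_{n\ge0}\overline p(n)q^n=\prod_{j\ge1}\frac{1+q^j}{1-q^j}$. A composition is an ordered finite sequence of positive integers (its parts), the empty composition included; $|c|$ is the sum of the parts and $\ell(c)$ the number of parts; $\mathcal C_{S}$ is the set of compositions all of whose parts lie in $S$. -}

module Defs where

open import Data.Nat using (ℕ; zero; suc; _<_; _≤_; _*_)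
open import Data.Bool using (Bool; false)
open import Data.Product using (Σ; ∃; _×_; _,_; proj₁)
open import Data.Sum using (_⊎_)
open import Data.List using (List; []; _∷_; map; length)
open import Data.Nat.ListAction using (sum)
open import Data.List.Relation.Unary.All using (All)
open import Data.List.Relation.Unary.Linked using (Linked)
open import Data.List.Relation.Unary.Unique.Propositional using (Unique)
open import Data.List.Membership.Propositional using (_∈_)
open import Data.Integer as ℤ using (ℤ)
open import Function.Bundles using (_⇔_)
open import Relation.Binary.PropositionalEquality using (_≡_)

-- A part of an overpartition: its value and whether it is overlined.
Part : Set
Part = ℕ × Bool

-- Canonical ordering of an overpartition written as a list:
-- values weakly decreasing; among equal values only the first may be overlined.
-- (p , x) followed by (q , y): either q < p, or q ≡ p and y is not overlined.
OrdStep : Part → Part → Set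
OrdStep (p , x) (q , y) = (q < p) ⊎ ((q ≡ p) × (y ≡ false))

Overpartition : ℕ → Set
Overpartition n =
  Σ (List Part) λ xs →
    All (λ pt → 1 ≤ proj₁ pt) xs × Linked OrdStep xs × (sum (map proj₁ xs) ≡ n)

IsPosSquare : ℕ → Set
IsPosSquare k = Σ ℕ λ m → (1 ≤ m) × (k ≡ m * m)

SqComp : ℕ → List ℕ → Set
SqComp n c = All IsPosSquare c × (sum c ≡ n)

EnumSqComp : ℕ → List (List ℕ) → Set
EnumSqComp n cs = Unique cs × (∀ c → (c ∈ cs) ⇔ SqComp n c)

weight : List ℕ → ℤ
weight c = (ℤ.- (ℤ.+ 2)) ℤ.^ length c

sumℤ : List ℤ → ℤ
sumℤ [] = ℤ.+ 0
sumℤ (x ∷ xs) = x ℤ.+ sumℤ xs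

module Submission where

-- By Gauss's identity ∏_{j≥1} (1 - q^j)/(1 + q^j) = ∑_{k∈ℤ} (-1)^k q^(k²), the overpartition numbers
-- are determined by p̄(0) = 1 and ∑_{k∈ℤ} (-1)^k p̄(n - k²) = 0 for n ≥ 1. The numbers
-- (-1)^n ∑_c (-2)^ℓ(c) obey the same recurrence: removing the first part k² of a composition
-- contributes a factor -2, and (-1)^(k²) = (-1)^k.
--
-- Gauss's identity is the case z = -1 of the finite Jacobi triple product
--   ∏_{i<m} (1 + z q^(2i+1)) (1 + z^-1 q^(2i+1)) = ∑_{|k|≤m} z^k q^(k²) [2m choose m-k]_{q²},
-- proved by induction on m. At z = -1 the left side is (q; q²)_m² = ∏_{i<m} (1 - q^(2i+1))²; dividing by it
-- gives 1 = ∑_k (-1)^k q^(k²) ∏_{j≤2m} (1 + q^j)/(1 - q^j) · R_k, where the ratio R_k of q²-factorials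
-- is 1 below degree 2(m - |k|) + 2, so comparing coefficients of degree at most m gives the recurrence.
-- Counting overpartitions by their largest part shows that ∏_{j≤P} (1 + q^j)/(1 - q^j) counts
-- those with parts at most P.

module FormalPowerSeries where

  open import Data.Nat as ℕ using (ℕ; zero; suc)
  import Data.Nat.Properties as ℕP
  open import Data.Integer as ℤ using (ℤ; 0ℤ; 1ℤ)
  import Data.Integer.Properties as ℤP
  import Data.Integer.Tactic.RingSolver as ℤSolver
  open import Data.Maybe using (Maybe; just; nothing)
  open import Data.Product using (_,_)
  open import Data.Vec using (Vec; []; _∷_; lookup; map)
  open import Data.Vec.Properties using (lookup-map)
  open import Data.Vec.Relation.Binary.Pointwise.Inductive as Pointwise using (Pointwise; []; _∷_)
  open import Relation.Nullary using (yes; no)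
  open import Relation.Binary.PropositionalEquality
  open import Function using (_∘_)
  open import Algebra.Bundles using (CommutativeRing)
  open import Algebra.Structures using (IsCommutativeRing)
  open import Algebra.Solver.Ring.AlmostCommutativeRing
    using (AlmostCommutativeRing; _-Raw-AlmostCommutative⟶_; fromCommutativeRing)
  import Algebra.Solver.Ring as RingSolver
  open import Algebra.Solver.Ring using ([+]; [*])
  import Algebra.Properties.Semiring.Exp as SemiringExp
  import Relation.Binary.Reasoning.Setoid as SetoidReasoning

  Series : Set
  Series = ℕ → ℤ

  infix 4 _≈_
  record _≈_ (f g : Series) : Set where
    constructor mk≈
    field coeff : f ≗ g
  open _≈_ public

  ≈-refl : ∀ {f} → f ≈ f
  ≈-refl = mk≈ λ _ → refl

  ≈-sym : ∀ {f g} → f ≈ g → g ≈ f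
  ≈-sym p = mk≈ λ n → sym (coeff p n)

  ≈-trans : ∀ {f g h} → f ≈ g → g ≈ h → f ≈ h
  ≈-trans p q = mk≈ λ n → trans (coeff p n) (coeff q n)

  ≈-reflexive : ∀ {f g} → f ≡ g → f ≈ g
  ≈-reflexive refl = ≈-refl

  -- Opaque, so that type checking compares series expressions instead of unfolding them into
  -- coefficient functions.
  opaque
    infixl 6 _+ₛ_
    infixl 7 _*ₛ_ _·ₛ_

    _+ₛ_ : Series → Series → Series
    (f +ₛ g) n = f n ℤ.+ g n

    -ₛ_ : Series → Series
    (-ₛ f) n = ℤ.- f n

    0ₛ : Series
    0ₛ _ = 0ℤ

    constₛ : ℤ → Series
    constₛ c zero = c
    constₛ c (suc _) = 0ℤ

    _·ₛ_ : ℤ → Series → Series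
    (c ·ₛ f) n = c ℤ.* f n

    _*ₛ_ : Series → Series → Series
    (f *ₛ g) zero = f 0 ℤ.* g 0
    (f *ₛ g) (suc n) = f 0 ℤ.* g (suc n) ℤ.+ ((f ∘ suc) *ₛ g) n

  1ₛ : Series
  1ₛ = constₛ 1ℤ

  q^_ : ℕ → Series
  (q^ zero) zero = 1ℤ
  (q^ zero) (suc n) = 0ℤ
  (q^ suc k) zero = 0ℤ
  (q^ suc k) (suc n) = (q^ k) n

  shift : ℕ → Series → Series
  shift zero f = f
  shift (suc k) f zero = 0ℤ
  shift (suc k) f (suc n) = shift k f n

  -- geometricFrom j r = q^r / (1 - q^(suc j)), by counting down r to the next multiple of suc j.
  geometricFrom : ℕ → ℕ → Series
  geometricFrom j zero zero = 1ℤ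
  geometricFrom j zero (suc n) = geometricFrom j j n
  geometricFrom j (suc r) zero = 0ℤ
  geometricFrom j (suc r) (suc n) = geometricFrom j r n

  -- geometric k = 1 / (1 - q^k); the value at k = 0, where no inverse exists, is junk.
  geometric : ℕ → Series
  geometric zero = 0ₛ
  geometric (suc j) = geometricFrom j zero

  geometricFrom-shift : ∀ j r → geometricFrom j r ≗ shift r (geometricFrom j zero)
  geometricFrom-shift j zero n = refl
  geometricFrom-shift j (suc r) zero = refl
  geometricFrom-shift j (suc r) (suc n) = geometricFrom-shift j r n

  1-q^_ : ℕ → Series
  1-q^ k = 1ₛ +ₛ (-ₛ q^ k)

  1+q^_ : ℕ → Series
  1+q^ k = 1ₛ +ₛ q^ k

  product : (ℕ → Series) → ℕ → Series
  product F zero = 1ₛ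
  product F (suc a) = product F a *ₛ F a

  opaque
    unfolding _+ₛ_ -ₛ_ 0ₛ constₛ _·ₛ_ _*ₛ_

    +ₛ-coeff : ∀ f g n → (f +ₛ g) n ≡ f n ℤ.+ g n
    +ₛ-coeff f g n = refl

    -ₛ-coeff : ∀ f n → (-ₛ f) n ≡ ℤ.- f n
    -ₛ-coeff f n = refl

    0ₛ-coeff : ∀ n → 0ₛ n ≡ 0ℤ
    0ₛ-coeff n = refl

    constₛ-coeff-zero : ∀ c → constₛ c 0 ≡ c
    constₛ-coeff-zero c = refl

    constₛ-coeff-suc : ∀ c n → constₛ c (suc n) ≡ 0ℤ
    constₛ-coeff-suc c n = refl

    *-cong-≗ : ∀ {f f' g g'} → f ≗ f' → g ≗ g' → f *ₛ g ≗ f' *ₛ g'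
    *-cong-≗ p q zero = cong₂ ℤ._*_ (p 0) (q 0)
    *-cong-≗ p q (suc n) =
      cong₂ ℤ._+_ (cong₂ ℤ._*_ (p 0) (q (suc n))) (*-cong-≗ (p ∘ suc) q n)

    *-zeroˡ-≗ : ∀ f g → (∀ k → f k ≡ 0ℤ) → f *ₛ g ≗ 0ₛ
    *-zeroˡ-≗ f g z zero rewrite z 0 = refl
    *-zeroˡ-≗ f g z (suc n) rewrite z 0 | *-zeroˡ-≗ (f ∘ suc) g (z ∘ suc) n = refl

    *-identityˡ-≗ : ∀ g → 1ₛ *ₛ g ≗ g
    *-identityˡ-≗ g zero = ℤP.*-identityˡ (g 0)
    *-identityˡ-≗ g (suc n) rewrite *-zeroˡ-≗ (1ₛ ∘ suc) g (λ _ → refl) n =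
      trans (ℤP.+-identityʳ _) (ℤP.*-identityˡ (g (suc n)))

    *-distribʳ-+-≗ : ∀ f f' g → (f +ₛ f') *ₛ g ≗ f *ₛ g +ₛ f' *ₛ g
    *-distribʳ-+-≗ f f' g zero = ℤP.*-distribʳ-+ (g 0) (f 0) (f' 0)
    *-distribʳ-+-≗ f f' g (suc n)
      rewrite *-distribʳ-+-≗ (f ∘ suc) (f' ∘ suc) g n | ℤP.*-distribʳ-+ (g (suc n)) (f 0) (f' 0) =
      interchange (f 0 ℤ.* g (suc n)) (f' 0 ℤ.* g (suc n)) (((f ∘ suc) *ₛ g) n) (((f' ∘ suc) *ₛ g) n)
      where
      interchange : ∀ a b c d → a ℤ.+ b ℤ.+ (c ℤ.+ d) ≡ a ℤ.+ c ℤ.+ (b ℤ.+ d)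
      interchange = ℤSolver.solve-∀

    ·-*-assoc-≗ : ∀ c f g → (c ·ₛ f) *ₛ g ≗ c ·ₛ (f *ₛ g)
    ·-*-assoc-≗ c f g zero = ℤP.*-assoc c (f 0) (g 0)
    ·-*-assoc-≗ c f g (suc n) rewrite ·-*-assoc-≗ c (f ∘ suc) g n | ℤP.*-assoc c (f 0) (g (suc n)) =
      sym (ℤP.*-distribˡ-+ c (f 0 ℤ.* g (suc n)) (((f ∘ suc) *ₛ g) n))

    *-suc-unfoldʳ : ∀ f g n → (f *ₛ g) (suc n) ≡ (f *ₛ (g ∘ suc)) n ℤ.+ f (suc n) ℤ.* g 0
    *-suc-unfoldʳ f g zero = refl
    *-suc-unfoldʳ f g (suc n) rewrite *-suc-unfoldʳ (f ∘ suc) g n =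
      sym (ℤP.+-assoc (f 0 ℤ.* g (suc (suc n))) (((f ∘ suc) *ₛ (g ∘ suc)) n) (f (suc (suc n)) ℤ.* g 0))

    *-comm-≗ : ∀ f g → f *ₛ g ≗ g *ₛ f
    *-comm-≗ f g zero = ℤP.*-comm (f 0) (g 0)
    *-comm-≗ f g (suc n) rewrite *-suc-unfoldʳ g f n | *-comm-≗ (f ∘ suc) g n =
      trans (ℤP.+-comm (f 0 ℤ.* g (suc n)) ((g *ₛ (f ∘ suc)) n))
            (cong (λ z → (g *ₛ (f ∘ suc)) n ℤ.+ z) (ℤP.*-comm (f 0) (g (suc n))))

    *-suc-unfold : ∀ f g → (f *ₛ g) ∘ suc ≗ (f 0 ·ₛ (g ∘ suc)) +ₛ ((f ∘ suc) *ₛ g)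
    *-suc-unfold f g n = refl

    *-assoc-≗ : ∀ f g h → (f *ₛ g) *ₛ h ≗ f *ₛ (g *ₛ h)
    *-assoc-≗ f g h zero = ℤP.*-assoc (f 0) (g 0) (h 0)
    *-assoc-≗ f g h (suc n) = begin
        (f 0 ℤ.* g 0) ℤ.* h (suc n) ℤ.+ (((f *ₛ g) ∘ suc) *ₛ h) n
      ≡⟨ cong₂ ℤ._+_ (ℤP.*-assoc (f 0) (g 0) (h (suc n))) tail ⟩
        f 0 ℤ.* (g 0 ℤ.* h (suc n)) ℤ.+ (f 0 ℤ.* ((g ∘ suc) *ₛ h) n ℤ.+ ((f ∘ suc) *ₛ (g *ₛ h)) n)
      ≡⟨ sym (ℤP.+-assoc (f 0 ℤ.* (g 0 ℤ.* h (suc n))) _ _) ⟩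
        f 0 ℤ.* (g 0 ℤ.* h (suc n)) ℤ.+ f 0 ℤ.* ((g ∘ suc) *ₛ h) n ℤ.+ ((f ∘ suc) *ₛ (g *ₛ h)) n
      ≡⟨ cong₂ ℤ._+_ (sym (ℤP.*-distribˡ-+ (f 0) (g 0 ℤ.* h (suc n)) (((g ∘ suc) *ₛ h) n))) refl ⟩
        f 0 ℤ.* (g *ₛ h) (suc n) ℤ.+ ((f ∘ suc) *ₛ (g *ₛ h)) n
      ∎
      where
      open ≡-Reasoning
      tail : (((f *ₛ g) ∘ suc) *ₛ h) n
             ≡ f 0 ℤ.* ((g ∘ suc) *ₛ h) n ℤ.+ ((f ∘ suc) *ₛ (g *ₛ h)) n
      tail = trans (*-cong-≗ (*-suc-unfold f g) (λ _ → refl) n)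
        (trans (*-distribʳ-+-≗ (f 0 ·ₛ (g ∘ suc)) ((f ∘ suc) *ₛ g) h n)
          (cong₂ ℤ._+_ (·-*-assoc-≗ (f 0) (g ∘ suc) h n) (*-assoc-≗ (f ∘ suc) g h n)))

    *-distribˡ-+-≗ : ∀ f g g' → f *ₛ (g +ₛ g') ≗ f *ₛ g +ₛ f *ₛ g'
    *-distribˡ-+-≗ f g g' n = trans (*-comm-≗ f _ n) (trans (*-distribʳ-+-≗ g g' f n)
      (cong₂ ℤ._+_ (*-comm-≗ g f n) (*-comm-≗ g' f n)))

    *-coeff-local : ∀ n f f' g g' → (∀ i → i ℕ.≤ n → f i ≡ f' i) → (∀ i → i ℕ.≤ n → g i ≡ g' i) →
                    (f *ₛ g) n ≡ (f' *ₛ g') n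
    *-coeff-local zero f f' g g' p q = cong₂ ℤ._*_ (p 0 ℕ.z≤n) (q 0 ℕ.z≤n)
    *-coeff-local (suc n) f f' g g' p q =
      cong₂ ℤ._+_ (cong₂ ℤ._*_ (p 0 ℕ.z≤n) (q (suc n) ℕP.≤-refl))
        (*-coeff-local n (f ∘ suc) (f' ∘ suc) g g' (λ i i≤n → p (suc i) (ℕ.s≤s i≤n))
                       (λ i i≤n → q i (ℕP.m≤n⇒m≤1+n i≤n)))

    constₛ-*-coeff : ∀ c f n → (constₛ c *ₛ f) n ≡ c ℤ.* f n
    constₛ-*-coeff c f zero = refl
    constₛ-*-coeff c f (suc n) =
      trans (cong (λ z → c ℤ.* f (suc n) ℤ.+ z) (*-zeroˡ-≗ (constₛ c ∘ suc) f (λ _ → refl) n)) (ℤP.+-identityʳ _)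

    q^0 : q^ 0 ≈ 1ₛ
    q^0 = mk≈ λ { zero → refl ; (suc n) → refl }

    q^-*-≗ : ∀ k f → q^ k *ₛ f ≗ shift k f
    q^-*-≗ zero f = λ n → trans (*-cong-≗ (coeff q^0) (λ _ → refl) n) (*-identityˡ-≗ f n)
    q^-*-≗ (suc k) f zero = ℤP.*-zeroˡ (f 0)
    q^-*-≗ (suc k) f (suc n) = trans (cong (λ z → z ℤ.+ (q^ k *ₛ f) n) (ℤP.*-zeroˡ (f (suc n))))
      (trans (ℤP.+-identityˡ _) (q^-*-≗ k f n))

    geometric-unfold : ∀ j → geometric (suc j) ≗ 1ₛ +ₛ q^ suc j *ₛ geometric (suc j)
    geometric-unfold j zero =
      trans (sym (ℤP.+-identityʳ 1ℤ)) (cong (λ z → 1ℤ ℤ.+ z) (sym (q^-*-≗ (suc j) (geometricFrom j zero) zero)))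
    geometric-unfold j (suc n) =
      trans (geometricFrom-shift j j n) (trans (sym (ℤP.+-identityˡ _))
        (cong (λ z → 0ℤ ℤ.+ z) (sym (q^-*-≗ (suc j) (geometricFrom j zero) (suc n)))))

    isCommutativeRing : IsCommutativeRing _≈_ _+ₛ_ _*ₛ_ -ₛ_ 0ₛ 1ₛ
    isCommutativeRing = record
      { isRing = record
        { +-isAbelianGroup = record
          { isGroup = record
            { isMonoid = record
              { isSemigroup = record
                { isMagma = record
                  { isEquivalence = record { refl = ≈-refl ; sym = ≈-sym ; trans = ≈-trans }
                  ; ∙-cong = λ p q → mk≈ λ n → cong₂ ℤ._+_ (coeff p n) (coeff q n) }
                ; assoc = λ f g h → mk≈ λ n → ℤP.+-assoc (f n) (g n) (h n) }
              ; identity = (λ f → mk≈ λ n → ℤP.+-identityˡ (f n))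
                         , (λ f → mk≈ λ n → ℤP.+-identityʳ (f n)) }
            ; inverse = (λ f → mk≈ λ n → ℤP.+-inverseˡ (f n))
                      , (λ f → mk≈ λ n → ℤP.+-inverseʳ (f n))
            ; ⁻¹-cong = λ p → mk≈ λ n → cong ℤ.-_ (coeff p n) }
          ; comm = λ f g → mk≈ λ n → ℤP.+-comm (f n) (g n) }
        ; *-cong = λ p q → mk≈ (*-cong-≗ (coeff p) (coeff q))
        ; *-assoc = λ f g h → mk≈ (*-assoc-≗ f g h)
        ; *-identity = (λ g → mk≈ (*-identityˡ-≗ g))
                     , (λ g → mk≈ λ n → trans (*-comm-≗ g 1ₛ n) (*-identityˡ-≗ g n))
        ; distrib = (λ f g g' → mk≈ (*-distribˡ-+-≗ f g g'))
                  , (λ f g g' → mk≈ (*-distribʳ-+-≗ g g' f)) }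
      ; *-comm = λ f g → mk≈ (*-comm-≗ f g) }

    constₛ-0 : constₛ 0ℤ ≈ 0ₛ
    constₛ-0 = mk≈ λ { zero → refl ; (suc n) → refl }

    constₛ-neg : ∀ a → constₛ (ℤ.- a) ≈ -ₛ constₛ a
    constₛ-neg a = mk≈ λ { zero → refl ; (suc n) → refl }

    constₛ-+ : ∀ a b → constₛ (a ℤ.+ b) ≈ constₛ a +ₛ constₛ b
    constₛ-+ a b = mk≈ λ { zero → refl ; (suc n) → refl }

    constₛ-* : ∀ a b → constₛ (a ℤ.* b) ≈ constₛ a *ₛ constₛ b
    constₛ-* a b = mk≈ λ { zero → refl ; (suc n) → sym (trans (cong₂ ℤ._+_ (ℤP.*-zeroʳ a)
      (*-zeroˡ-≗ (constₛ a ∘ suc) (constₛ b) (λ _ → refl) n)) (ℤP.+-identityˡ 0ℤ)) }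

  seriesRing : CommutativeRing _ _
  seriesRing = record { isCommutativeRing = isCommutativeRing }

  open CommutativeRing seriesRing public
    using (+-cong; *-cong; -‿cong; +-identityˡ; +-identityʳ;
           *-assoc; *-comm; *-identityˡ; distribˡ; distribʳ; zeroʳ)

  constₛ-homomorphism : CommutativeRing.rawRing ℤP.+-*-commutativeRing
                        -Raw-AlmostCommutative⟶ fromCommutativeRing seriesRing
  constₛ-homomorphism = record
    { ⟦_⟧ = constₛ ; +-homo = constₛ-+ ; *-homo = constₛ-* ; -‿homo = constₛ-neg ; 0-homo = constₛ-0 ; 1-homo = ≈-refl }

  constₛ-≟ : ∀ a b → Maybe (constₛ a ≈ constₛ b)
  constₛ-≟ a b with a ℤ.≟ b
  ... | yes refl = just ≈-refl
  ... | no _ = nothing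

  module SeriesSolver = RingSolver (CommutativeRing.rawRing ℤP.+-*-commutativeRing)
    (fromCommutativeRing seriesRing) constₛ-homomorphism constₛ-≟
  open SeriesSolver public using (solve; _:=_; _:+_; _:*_; _:-_; :-_; con; _:^_; Polynomial; var; ⟦_⟧; ⟦_⟧↓; prove)

  module ≈-Reasoning = SetoidReasoning (CommutativeRing.setoid seriesRing)

  q^-*-shift : ∀ k f → q^ k *ₛ f ≈ shift k f
  q^-*-shift k f = mk≈ (q^-*-≗ k f)

  q^-+ : ∀ a b → q^ (a ℕ.+ b) ≈ q^ a *ₛ q^ b
  q^-+ a b = ≈-sym (≈-trans (q^-*-shift a (q^ b)) (mk≈ (shift-q^ a)))
    where
    shift-q^ : ∀ a → shift a (q^ b) ≗ q^ (a ℕ.+ b)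
    shift-q^ zero n = refl
    shift-q^ (suc a) zero = refl
    shift-q^ (suc a) (suc n) = shift-q^ a n

  shift-below : ∀ k f n → n ℕ.< k → shift k f n ≡ 0ℤ
  shift-below (suc k) f zero p = refl
  shift-below (suc k) f (suc n) (ℕ.s≤s p) = shift-below k f n p

  shift-above : ∀ k f n → k ℕ.≤ n → shift k f n ≡ f (n ℕ.∸ k)
  shift-above k f n k≤n = trans (cong (shift k f) (sym (ℕP.m+[n∸m]≡n k≤n))) (shift-+ k (n ℕ.∸ k))
    where
    shift-+ : ∀ k n → shift k f (k ℕ.+ n) ≡ f n
    shift-+ zero n = refl
    shift-+ (suc k) n = shift-+ k n

  1-q^-*-coeff : ∀ k f n → (1-q^ k *ₛ f) n ≡ f n ℤ.- shift k f n
  1-q^-*-coeff k f n =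
    trans (coeff (solve 2 (λ M X → (con 1ℤ :- M) :* X := X :- M :* X) ≈-refl (q^ k) f) n)
      (trans (+ₛ-coeff f _ n) (cong (λ z → f n ℤ.+ z) (trans (-ₛ-coeff _ n) (cong ℤ.-_ (coeff (q^-*-shift k f) n)))))

  1+q^-*-coeff : ∀ k f n → (1+q^ k *ₛ f) n ≡ f n ℤ.+ shift k f n
  1+q^-*-coeff k f n =
    trans (coeff (solve 2 (λ M X → (con 1ℤ :+ M) :* X := X :+ M :* X) ≈-refl (q^ k) f) n)
      (trans (+ₛ-coeff f _ n) (cong (λ z → f n ℤ.+ z) (coeff (q^-*-shift k f) n)))

  1-q^-*-geometric : ∀ j → 1-q^ suc j *ₛ geometric (suc j) ≈ 1ₛ
  1-q^-*-geometric j = begin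
      1-q^ suc j *ₛ G
    ≈⟨ solve 2 (λ M G → (con 1ℤ :- M) :* G := G :- M :* G) ≈-refl (q^ suc j) G ⟩
      G +ₛ (-ₛ (q^ suc j *ₛ G))
    ≈⟨ +-cong (mk≈ (geometric-unfold j)) ≈-refl ⟩
      (1ₛ +ₛ q^ suc j *ₛ G) +ₛ (-ₛ (q^ suc j *ₛ G))
    ≈⟨ solve 1 (λ X → (con 1ℤ :+ X) :- X := con 1ℤ) ≈-refl (q^ suc j *ₛ G) ⟩
      1ₛ
    ∎
    where
    open ≈-Reasoning
    G = geometric (suc j)

  geometric-solves : ∀ j {f g} → 1-q^ suc j *ₛ f ≈ g → f ≈ geometric (suc j) *ₛ g
  geometric-solves j {f} {g} h = begin
      f
    ≈⟨ ≈-sym (*-identityˡ f) ⟩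
      1ₛ *ₛ f
    ≈⟨ *-cong (≈-sym (≈-trans (*-comm _ _) (1-q^-*-geometric j))) ≈-refl ⟩
      geometric (suc j) *ₛ 1-q^ suc j *ₛ f
    ≈⟨ *-assoc _ _ _ ⟩
      geometric (suc j) *ₛ (1-q^ suc j *ₛ f)
    ≈⟨ *-cong ≈-refl h ⟩
      geometric (suc j) *ₛ g
    ∎
    where open ≈-Reasoning

  product-* : ∀ F H a → product F a *ₛ product H a ≈ product (λ i → F i *ₛ H i) a
  product-* F H zero = *-identityˡ 1ₛ
  product-* F H (suc a) = ≈-trans
    (solve 4 (λ A B C D → (A :* C) :* (B :* D) := (A :* B) :* (C :* D)) ≈-refl (product F a) (product H a) (F a) (H a))
    (*-cong (product-* F H a) ≈-refl)

  product-≈1 : ∀ F a → (∀ i → F i ≈ 1ₛ) → product F a ≈ 1ₛ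
  product-≈1 F zero h = ≈-refl
  product-≈1 F (suc a) h = ≈-trans (*-cong (product-≈1 F a h) (h a)) (*-identityˡ 1ₛ)

  infix 4 _≈[_]_
  _≈[_]_ : Series → ℕ → Series → Set
  f ≈[ N ] g = ∀ n → n ℕ.< N → f n ≡ g n

  ≈⇒≈[] : ∀ {N f g} → f ≈ g → f ≈[ N ] g
  ≈⇒≈[] p n _ = coeff p n

  ≈[]-trans : ∀ {N f g h} → f ≈[ N ] g → g ≈[ N ] h → f ≈[ N ] h
  ≈[]-trans p q n l = trans (p n l) (q n l)

  ≈[]-weaken : ∀ {N N' f g} → N' ℕ.≤ N → f ≈[ N ] g → f ≈[ N' ] g
  ≈[]-weaken le p n l = p n (ℕP.<-≤-trans l le)

  *-≈[] : ∀ {N f f' g g'} → f ≈[ N ] f' → g ≈[ N ] g' → f *ₛ g ≈[ N ] f' *ₛ g'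
  *-≈[] {f = f} {f'} {g} {g'} p q n n<N =
    *-coeff-local n f f' g g' (λ i i≤n → p i (ℕP.≤-<-trans i≤n n<N)) (λ i i≤n → q i (ℕP.≤-<-trans i≤n n<N))

  *-≈[]1 : ∀ {N f g} → f ≈[ N ] 1ₛ → g ≈[ N ] 1ₛ → f *ₛ g ≈[ N ] 1ₛ
  *-≈[]1 p q = ≈[]-trans (*-≈[] p q) (≈⇒≈[] (*-identityˡ 1ₛ))

  shift-≈[] : ∀ a {N f g} → f ≈[ N ] g → shift a f ≈[ a ℕ.+ N ] shift a g
  shift-≈[] zero p = p
  shift-≈[] (suc a) p zero l = refl
  shift-≈[] (suc a) p (suc n) (ℕ.s≤s l) = shift-≈[] a p n l

  q^-≈[]0 : ∀ k → q^ k ≈[ k ] 0ₛ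
  q^-≈[]0 (suc k) zero l = sym (0ₛ-coeff 0)
  q^-≈[]0 (suc k) (suc n) (ℕ.s≤s l) = trans (q^-≈[]0 k n l) (trans (0ₛ-coeff n) (sym (0ₛ-coeff (suc n))))

  1-q^-≈[]1 : ∀ k → 1-q^ k ≈[ k ] 1ₛ
  1-q^-≈[]1 k n l = trans (+ₛ-coeff 1ₛ _ n)
    (trans (cong (λ z → 1ₛ n ℤ.+ z) (trans (-ₛ-coeff (q^ k) n) (cong ℤ.-_ (trans (q^-≈[]0 k n l) (0ₛ-coeff n)))))
      (ℤP.+-identityʳ (1ₛ n)))

  1+q^-≈[]1 : ∀ k → 1+q^ k ≈[ k ] 1ₛ
  1+q^-≈[]1 k n l = trans (+ₛ-coeff 1ₛ _ n)
    (trans (cong (λ z → 1ₛ n ℤ.+ z) (trans (q^-≈[]0 k n l) (0ₛ-coeff n))) (ℤP.+-identityʳ (1ₛ n)))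

  geometric-≈[]1 : ∀ j → geometric (suc j) ≈[ suc j ] 1ₛ
  geometric-≈[]1 j zero l = sym (constₛ-coeff-zero 1ℤ)
  geometric-≈[]1 j (suc n) (ℕ.s≤s l) =
    trans (geometricFrom-shift j j n) (trans (shift-below j _ n l) (sym (constₛ-coeff-suc 1ℤ n)))

  open SemiringExp (AlmostCommutativeRing.semiring (fromCommutativeRing seriesRing)) public using (_^_; ^-congˡ)

  -- The solver sees q^(2k+5) as an unrelated atom; to normalise identities between such atoms we
  -- substitute their expansions as monomials in a few base atoms (q, q^k, ...) and normalise that.
  substitute : ∀ {n m} → Polynomial n → Vec (Polynomial m) n → Polynomial m
  substitute (SeriesSolver.op o p p') σ = SeriesSolver.op o (substitute p σ) (substitute p' σ)
  substitute (con c) σ = con c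
  substitute (var x) σ = lookup σ x
  substitute (p :^ k) σ = substitute p σ :^ k
  substitute (:- p) σ = :- substitute p σ

  ⟦substitute⟧ : ∀ {n m} (p : Polynomial n) (σ : Vec (Polynomial m) n) (ρ : Vec Series m) →
                 ⟦ substitute p σ ⟧ ρ ≈ ⟦ p ⟧ (map (λ e → ⟦ e ⟧ ρ) σ)
  ⟦substitute⟧ (SeriesSolver.op [+] p p') σ ρ = +-cong (⟦substitute⟧ p σ ρ) (⟦substitute⟧ p' σ ρ)
  ⟦substitute⟧ (SeriesSolver.op [*] p p') σ ρ = *-cong (⟦substitute⟧ p σ ρ) (⟦substitute⟧ p' σ ρ)
  ⟦substitute⟧ (con c) σ ρ = ≈-refl
  ⟦substitute⟧ (var x) σ ρ = ≈-reflexive (sym (lookup-map x (λ e → ⟦ e ⟧ ρ) σ))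
  ⟦substitute⟧ (p :^ k) σ ρ = ^-congˡ k (⟦substitute⟧ p σ ρ)
  ⟦substitute⟧ (:- p) σ ρ = -‿cong (⟦substitute⟧ p σ ρ)

  ⟦⟧-cong : ∀ {n} (p : Polynomial n) {ρ ρ' : Vec Series n} → Pointwise _≈_ ρ ρ' → ⟦ p ⟧ ρ ≈ ⟦ p ⟧ ρ'
  ⟦⟧-cong (SeriesSolver.op [+] p p') e = +-cong (⟦⟧-cong p e) (⟦⟧-cong p' e)
  ⟦⟧-cong (SeriesSolver.op [*] p p') e = *-cong (⟦⟧-cong p e) (⟦⟧-cong p' e)
  ⟦⟧-cong (con c) e = ≈-refl
  ⟦⟧-cong (var x) e = Pointwise.lookup e x
  ⟦⟧-cong (p :^ k) e = ^-congˡ k (⟦⟧-cong p e)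
  ⟦⟧-cong (:- p) e = -‿cong (⟦⟧-cong p e)

  prove-by-substitution : ∀ {n m} (p : Polynomial n) (p' : Polynomial m) (ρ : Vec Series n)
    (σ : Vec (Polynomial m) n) (ρ₀ : Vec Series m) →
    Pointwise _≈_ ρ (map (λ e → ⟦ e ⟧ ρ₀) σ) →
    ⟦ substitute p σ ⟧↓ ρ₀ ≈ ⟦ p' ⟧↓ ρ₀ →
    ⟦ p ⟧ ρ ≈ ⟦ p' ⟧ ρ₀
  prove-by-substitution p p' ρ σ ρ₀ e h =
    ≈-trans (⟦⟧-cong p e) (≈-trans (≈-sym (⟦substitute⟧ p σ ρ₀)) (prove ρ₀ (substitute p σ) p' h))

  q^-*-pow : ∀ c k → q^ (c ℕ.* k) ≈ q^ k ^ c
  q^-*-pow zero k = q^0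
  q^-*-pow (suc c) k = ≈-trans (q^-+ k (c ℕ.* k)) (*-cong ≈-refl (q^-*-pow c k))

  q^-linear : ∀ {e} c₀ c₁ c₂ k d → e ≡ c₀ ℕ.+ c₁ ℕ.* k ℕ.+ c₂ ℕ.* d →
              q^ e ≈ q^ 1 ^ c₀ *ₛ q^ k ^ c₁ *ₛ q^ d ^ c₂
  q^-linear c₀ c₁ c₂ k d refl =
    ≈-trans (q^-+ (c₀ ℕ.+ c₁ ℕ.* k) (c₂ ℕ.* d)) (*-cong
      (≈-trans (q^-+ c₀ (c₁ ℕ.* k))
        (*-cong (≈-trans (≈-reflexive (cong q^_ (sym (ℕP.*-identityʳ c₀)))) (q^-*-pow c₀ 1)) (q^-*-pow c₁ k)))
      (q^-*-pow c₂ d))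

  q^-linear+square : ∀ {e} c₀ c₁ c₂ k d → e ≡ c₀ ℕ.+ c₁ ℕ.* k ℕ.+ c₂ ℕ.* d ℕ.+ k ℕ.* k →
                     q^ e ≈ q^ 1 ^ c₀ *ₛ q^ k ^ c₁ *ₛ q^ d ^ c₂ *ₛ q^ (k ℕ.* k)
  q^-linear+square c₀ c₁ c₂ k d refl =
    ≈-trans (q^-+ (c₀ ℕ.+ c₁ ℕ.* k ℕ.+ c₂ ℕ.* d) (k ℕ.* k)) (*-cong (q^-linear c₀ c₁ c₂ k d refl) ≈-refl)

  1-q^-linear : ∀ {e} c₀ c₁ c₂ k d → e ≡ c₀ ℕ.+ c₁ ℕ.* k ℕ.+ c₂ ℕ.* d →
                1-q^ e ≈ 1ₛ +ₛ (-ₛ (q^ 1 ^ c₀ *ₛ q^ k ^ c₁ *ₛ q^ d ^ c₂))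
  1-q^-linear c₀ c₁ c₂ k d eq = +-cong ≈-refl (-‿cong (q^-linear c₀ c₁ c₂ k d eq))

  1+q^-linear : ∀ {e} c₀ c₁ c₂ k d → e ≡ c₀ ℕ.+ c₁ ℕ.* k ℕ.+ c₂ ℕ.* d →
                1+q^ e ≈ 1ₛ +ₛ (q^ 1 ^ c₀ *ₛ q^ k ^ c₁ *ₛ q^ d ^ c₂)
  1+q^-linear c₀ c₁ c₂ k d eq = +-cong ≈-refl (q^-linear c₀ c₁ c₂ k d eq)

module TripleProduct where

  open import Data.Nat as ℕ using (ℕ; zero; suc; _+_; _*_)
  import Data.Nat.Properties as ℕP
  import Data.Nat.Tactic.RingSolver as ℕSolver
  open import Data.Integer as ℤ using (ℤ; +_; -[1+_]; 0ℤ; 1ℤ)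
  open import Data.Vec using (Vec; []; _∷_)
  open import Data.Vec.Relation.Binary.Pointwise.Inductive using ([]; _∷_)
  open import Data.Fin using (Fin; #_)
  open import Function using (_∘_)
  open import Relation.Binary.PropositionalEquality
  open FormalPowerSeries
  open ≈-Reasoning

  linearCoeff : ℕ → Series
  linearCoeff m = q^ suc (2 * m)

  constantCoeff : ℕ → Series
  constantCoeff m = 1+q^ (suc (2 * m) + suc (2 * m))

  -- tripleCoeff m k is the coefficient of z^k (and of z^-k) in
  -- ∏_{i<m} (1 + z q^(2i+1)) (1 + z^-1 q^(2i+1)); multiplying by the next factor
  -- linearCoeff m · z + constantCoeff m + linearCoeff m · z^-1 gives the recursion.
  tripleCoeff : ℕ → ℕ → Series
  tripleCoeff zero zero = 1ₛ
  tripleCoeff zero (suc k) = 0ₛ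
  tripleCoeff (suc m) zero =
    constₛ (+ 2) *ₛ (linearCoeff m *ₛ tripleCoeff m 1) +ₛ constantCoeff m *ₛ tripleCoeff m 0
  tripleCoeff (suc m) (suc k) =
    linearCoeff m *ₛ tripleCoeff m k +ₛ constantCoeff m *ₛ tripleCoeff m (suc k)
      +ₛ linearCoeff m *ₛ tripleCoeff m (suc (suc k))

  tripleCoeff-vanishes : ∀ m k → m ℕ.< k → tripleCoeff m k ≈ 0ₛ
  tripleCoeff-vanishes zero (suc k) l = ≈-refl
  tripleCoeff-vanishes (suc m) (suc k) (ℕ.s≤s l) = begin
      A *ₛ tripleCoeff m k +ₛ B *ₛ tripleCoeff m (suc k) +ₛ A *ₛ tripleCoeff m (suc (suc k))
    ≈⟨ +-cong (+-cong (*-cong ≈-refl (tripleCoeff-vanishes m k l))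
                      (*-cong ≈-refl (tripleCoeff-vanishes m (suc k) (ℕP.m≤n⇒m≤1+n l))))
              (*-cong ≈-refl (tripleCoeff-vanishes m (suc (suc k)) (ℕP.m≤n⇒m≤1+n (ℕP.m≤n⇒m≤1+n l)))) ⟩
      A *ₛ 0ₛ +ₛ B *ₛ 0ₛ +ₛ A *ₛ 0ₛ
    ≈⟨ +-cong (+-cong (zeroʳ A) (zeroʳ B)) (zeroʳ A) ⟩
      0ₛ +ₛ 0ₛ +ₛ 0ₛ
    ≈⟨ ≈-trans (+-cong (+-identityˡ 0ₛ) ≈-refl) (+-identityˡ 0ₛ) ⟩
      0ₛ
    ∎
    where
    A = linearCoeff m
    B = constantCoeff m

  -- The weight of k ≥ 0 once the terms of k and -k of a sum over ℤ with sign (-1)^k are merged.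
  foldedSign : ℕ → ℤ
  foldedSign zero = 1ℤ
  foldedSign (suc zero) = -[1+ 1 ]
  foldedSign (suc (suc L)) = ℤ.- foldedSign (suc L)

  foldedSum : (ℕ → Series) → ℕ → Series
  foldedSum F zero = F 0
  foldedSum F (suc L) = foldedSum F L +ₛ constₛ (foldedSign (suc L)) *ₛ F (suc L)

  foldedSum-step : ∀ m L → foldedSum (tripleCoeff (suc m)) (suc L) ≈
    (constantCoeff m +ₛ (-ₛ (constₛ (+ 2) *ₛ linearCoeff m))) *ₛ foldedSum (tripleCoeff m) (suc L)
      +ₛ constₛ (foldedSign (suc L)) *ₛ (linearCoeff m *ₛ (tripleCoeff m (suc L) +ₛ tripleCoeff m (suc (suc L))))
  foldedSum-step m zero = solve 5 (λ a b t0 t1 t2 →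
      (con (+ 2) :* (a :* t1) :+ b :* t0) :+ con (-[1+ 1 ]) :* (a :* t0 :+ b :* t1 :+ a :* t2)
      := (b :- con (+ 2) :* a) :* (t0 :+ con (-[1+ 1 ]) :* t1) :+ con (-[1+ 1 ]) :* (a :* (t1 :+ t2)))
    ≈-refl (linearCoeff m) (constantCoeff m) (tripleCoeff m 0) (tripleCoeff m 1) (tripleCoeff m 2)
  foldedSum-step m (suc L) = begin
      foldedSum (tripleCoeff (suc m)) (suc L) +ₛ constₛ (foldedSign (suc (suc L))) *ₛ tripleCoeff (suc m) (suc (suc L))
    ≈⟨ +-cong (foldedSum-step m L) (*-cong (constₛ-neg (foldedSign (suc L))) ≈-refl) ⟩
      C *ₛ F +ₛ S *ₛ (A *ₛ (T₁ +ₛ T₂)) +ₛ (-ₛ S) *ₛ tripleCoeff (suc m) (suc (suc L))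
    ≈⟨ solve 7 (λ a b F S t1 t2 t3 →
          (b :- con (+ 2) :* a) :* F :+ S :* (a :* (t1 :+ t2)) :+ (:- S) :* (a :* t1 :+ b :* t2 :+ a :* t3)
          := (b :- con (+ 2) :* a) :* (F :+ (:- S) :* t2) :+ (:- S) :* (a :* (t2 :+ t3)))
        ≈-refl A (constantCoeff m) F S T₁ T₂ T₃ ⟩
      C *ₛ (F +ₛ (-ₛ S) *ₛ T₂) +ₛ (-ₛ S) *ₛ (A *ₛ (T₂ +ₛ T₃))
    ≈⟨ ≈-sym (+-cong (*-cong ≈-refl (+-cong ≈-refl (*-cong (constₛ-neg (foldedSign (suc L))) ≈-refl)))
                     (*-cong (constₛ-neg (foldedSign (suc L))) ≈-refl)) ⟩
      C *ₛ foldedSum (tripleCoeff m) (suc (suc L)) +ₛ constₛ (foldedSign (suc (suc L))) *ₛ (A *ₛ (T₂ +ₛ T₃))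
    ∎
    where
    A = linearCoeff m
    C = constantCoeff m +ₛ (-ₛ (constₛ (+ 2) *ₛ A))
    F = foldedSum (tripleCoeff m) (suc L)
    S = constₛ (foldedSign (suc L))
    T₁ = tripleCoeff m (suc L)
    T₂ = tripleCoeff m (suc (suc L))
    T₃ = tripleCoeff m (suc (suc (suc L)))

  oddProduct : ℕ → Series
  oddProduct = product (λ i → 1-q^ suc (2 * i))

  foldedSum-tripleCoeff : ∀ m → foldedSum (tripleCoeff m) m ≈ oddProduct m *ₛ oddProduct m
  foldedSum-tripleCoeff zero = ≈-sym (*-identityˡ 1ₛ)
  foldedSum-tripleCoeff (suc m) = begin
      foldedSum (tripleCoeff (suc m)) (suc m)
    ≈⟨ foldedSum-step m m ⟩
      C *ₛ (foldedSum (tripleCoeff m) m +ₛ S *ₛ tripleCoeff m (suc m))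
        +ₛ S *ₛ (A *ₛ (tripleCoeff m (suc m) +ₛ tripleCoeff m (suc (suc m))))
    ≈⟨ +-cong (*-cong ≈-refl (+-cong (foldedSum-tripleCoeff m) (*-cong ≈-refl (tripleCoeff-vanishes m (suc m) ℕP.≤-refl))))
              (*-cong ≈-refl (*-cong ≈-refl (+-cong (tripleCoeff-vanishes m (suc m) ℕP.≤-refl)
                                                     (tripleCoeff-vanishes m (suc (suc m)) (ℕP.n≤1+n _))))) ⟩
      C *ₛ (oddProduct m *ₛ oddProduct m +ₛ S *ₛ 0ₛ) +ₛ S *ₛ (A *ₛ (0ₛ +ₛ 0ₛ))
    ≈⟨ +-cong (*-cong ≈-refl (+-cong ≈-refl (zeroʳ S)))
              (≈-trans (*-cong ≈-refl (≈-trans (*-cong ≈-refl (+-identityˡ 0ₛ)) (zeroʳ A))) (zeroʳ S)) ⟩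
      C *ₛ (oddProduct m *ₛ oddProduct m +ₛ 0ₛ) +ₛ 0ₛ
    ≈⟨ ≈-trans (+-identityʳ _) (*-cong (+-cong (+-cong ≈-refl (q^-+ (suc (2 * m)) (suc (2 * m)))) ≈-refl) (+-identityʳ _)) ⟩
      (1ₛ +ₛ A *ₛ A +ₛ (-ₛ (constₛ (+ 2) *ₛ A))) *ₛ (oddProduct m *ₛ oddProduct m)
    ≈⟨ solve 2 (λ a P → (con 1ℤ :+ a :* a :- con (+ 2) :* a) :* (P :* P)
          := (P :* (con 1ℤ :- a)) :* (P :* (con 1ℤ :- a))) ≈-refl A (oddProduct m) ⟩
      oddProduct (suc m) *ₛ oddProduct (suc m)
    ∎
    where
    A = linearCoeff m
    C = constantCoeff m +ₛ (-ₛ (constₛ (+ 2) *ₛ A))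
    S = constₛ (foldedSign (suc m))

  evenProduct : ℕ → Series
  evenProduct = product (λ i → 1-q^ (2 * suc i))

  evenProduct-suc-suc : ∀ a b → evenProduct (suc a + suc b) ≈
                        evenProduct (a + b) *ₛ 1-q^ (2 * suc (a + b)) *ₛ 1-q^ (2 * suc (suc (a + b)))
  evenProduct-suc-suc a b = ≈-reflexive (cong (evenProduct ∘ suc) (ℕP.+-suc a b))

  suc-square : ∀ k d → suc k * suc k ≡ 1 + 2 * k + 0 * d + k * k
  suc-square = ℕSolver.solve-∀

  -- tripleCoeff m k = q^(k²) [2m choose m-k] in base q², i.e. with d = m - k below.
  -- Each case feeds the recursion of tripleCoeff (suc m) with the closed forms at m (after
  -- multiplying through by the denominators), expands every atom as a monomial in q, q^k, q^d
  -- times q^(k²) and evenProduct (m + m), and normalises both sides to the same polynomial.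
  ClosedFormAt : ℕ → ℕ → ℕ → Set
  ClosedFormAt m k d =
    tripleCoeff m k *ₛ evenProduct d *ₛ evenProduct (k + m) ≈ q^ (k * k) *ₛ evenProduct (m + m)

  ClosedForm : ℕ → Set
  ClosedForm m = ∀ k d → k + d ≡ m → ClosedFormAt m k d

  closedForm-zero : ClosedFormAt 0 0 0
  closedForm-zero = ≈-sym (prove-by-substitution (var (# 0) :* con 1ℤ) (con 1ℤ :* con 1ℤ :* con 1ℤ)
    (q^ 0 ∷ []) (con 1ℤ ∷ []) [] (q^0 ∷ []) ≈-refl)

  closedForm-one : ClosedFormAt 1 0 1
  closedForm-one = ≈-trans lhs (≈-sym rhs)
    where
    q one : Polynomial 1
    q = var (# 0)
    one = con 1ℤ
    final : Polynomial 1
    final = (one :+ q :^ 2) :* (one :* (one :- q :^ 2)) :* (one :* (one :- q :^ 2))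
    lhs = prove-by-substitution
      ((con (+ 2) :* (var (# 0) :* var (# 2)) :+ var (# 1) :* con 1ℤ) :* (con 1ℤ :* var (# 3)) :* (con 1ℤ :* var (# 3)))
      final
      (linearCoeff 0 ∷ constantCoeff 0 ∷ tripleCoeff 0 1 ∷ 1-q^ 2 ∷ [])
      (q ∷ (one :+ q :^ 2) ∷ con 0ℤ ∷ (one :- q :^ 2) ∷ [])
      (q^ 1 ∷ [])
      (≈-refl ∷ +-cong ≈-refl (q^-*-pow 2 1) ∷ ≈-sym constₛ-0 ∷ +-cong ≈-refl (-‿cong (q^-*-pow 2 1)) ∷ [])
      ≈-refl
    rhs = prove-by-substitution (var (# 0) :* (con 1ℤ :* var (# 1) :* var (# 2))) final
      (q^ 0 ∷ 1-q^ 2 ∷ 1-q^ 4 ∷ [])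
      (one ∷ (one :- q :^ 2) ∷ (one :- q :^ 4) ∷ [])
      (q^ 1 ∷ [])
      (q^0 ∷ +-cong ≈-refl (-‿cong (q^-*-pow 2 1)) ∷ +-cong ≈-refl (-‿cong (q^-*-pow 4 1)) ∷ [])
      ≈-refl

  closedForm-centre : ∀ m → ClosedForm m → ClosedFormAt (suc m) 0 (suc m)
  closedForm-centre zero _ = closedForm-one
  closedForm-centre (suc m) ih = ≈-trans regroup (≈-trans expand (≈-sym rhs))
    where
    linear-exp : ∀ m → suc (2 * suc m) ≡ 3 + 2 * m + 0 * 0
    linear-exp = ℕSolver.solve-∀
    constant-exp : ∀ m → suc (2 * suc m) + suc (2 * suc m) ≡ 6 + 4 * m + 0 * 0
    constant-exp = ℕSolver.solve-∀
    u₁-exp : ∀ m → 2 * suc m ≡ 2 + 2 * m + 0 * 0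
    u₁-exp = ℕSolver.solve-∀
    u₂-exp : ∀ m → 2 * suc (suc m) ≡ 4 + 2 * m + 0 * 0
    u₂-exp = ℕSolver.solve-∀
    last-exp₁ : ∀ m → 2 * suc (suc m + suc m) ≡ 6 + 4 * m + 0 * 0
    last-exp₁ = ℕSolver.solve-∀
    last-exp₂ : ∀ m → 2 * suc (suc (suc m + suc m)) ≡ 8 + 4 * m + 0 * 0
    last-exp₂ = ℕSolver.solve-∀
    M = suc m
    A = linearCoeff M
    B = constantCoeff M
    T₁ = tripleCoeff M 1
    T₀ = tripleCoeff M 0
    P = evenProduct m
    u₁ = 1-q^ (2 * suc m)
    u₂ = 1-q^ (2 * suc (suc m))
    ρ : Vec Series 7
    ρ = A ∷ B ∷ T₁ ∷ T₀ ∷ P ∷ u₁ ∷ u₂ ∷ []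
    v : Fin 7 → Polynomial 7
    v i = var i
    regroup = prove-by-substitution
      ((con (+ 2) :* (v (# 0) :* v (# 2)) :+ v (# 1) :* v (# 3)) :* (v (# 4) :* v (# 5) :* v (# 6)) :* (v (# 4) :* v (# 5) :* v (# 6)))
      (con (+ 2) :* v (# 0) :* (v (# 2) :* v (# 4) :* (v (# 4) :* v (# 5) :* v (# 6))) :* (v (# 5) :* v (# 6))
        :+ v (# 1) :* (v (# 3) :* (v (# 4) :* v (# 5)) :* (v (# 4) :* v (# 5))) :* (v (# 6) :* v (# 6)))
      ρ (v (# 0) ∷ v (# 1) ∷ v (# 2) ∷ v (# 3) ∷ v (# 4) ∷ v (# 5) ∷ v (# 6) ∷ []) ρ
      (≈-refl ∷ ≈-refl ∷ ≈-refl ∷ ≈-refl ∷ ≈-refl ∷ ≈-refl ∷ ≈-refl ∷ []) ≈-refl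
    q x u Y one : Polynomial 4
    q = var (# 0)
    x = var (# 1)
    u = var (# 2)
    Y = var (# 3)
    one = con 1ℤ
    monomial : ℕ → ℕ → ℕ → Polynomial 4
    monomial a b c = q :^ a :* x :^ b :* u :^ c
    final : Polynomial 4
    final = one :* (Y :* (one :- monomial 6 4 0) :* (one :- monomial 8 4 0))
    base : Vec Series 4
    base = q^ 1 ∷ q^ m ∷ q^ 0 ∷ evenProduct (M + M) ∷ []
    w : Fin 6 → Polynomial 6
    w i = var i
    expand = prove-by-substitution
      (con (+ 2) :* w (# 0) :* w (# 2) :* (w (# 4) :* w (# 5)) :+ w (# 1) :* w (# 3) :* (w (# 5) :* w (# 5)))
      final
      (A ∷ B ∷ T₁ *ₛ P *ₛ (P *ₛ u₁ *ₛ u₂) ∷ T₀ *ₛ (P *ₛ u₁) *ₛ (P *ₛ u₁) ∷ u₁ ∷ u₂ ∷ [])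
      (monomial 3 2 0 ∷ (one :+ monomial 6 4 0) ∷ (q :* Y) ∷ (one :* Y) ∷ (one :- monomial 2 2 0) ∷ (one :- monomial 4 2 0) ∷ [])
      base
      (q^-linear 3 2 0 m 0 (linear-exp m) ∷ 1+q^-linear 6 4 0 m 0 (constant-exp m) ∷ ih 1 m refl
       ∷ ≈-trans (ih 0 (suc m) refl) (*-cong q^0 ≈-refl)
       ∷ 1-q^-linear 2 2 0 m 0 (u₁-exp m) ∷ 1-q^-linear 4 2 0 m 0 (u₂-exp m) ∷ [])
      ≈-refl
    rhs = prove-by-substitution (var (# 0) :* var (# 1)) final
      (q^ 0 ∷ evenProduct (suc M + suc M) ∷ [])
      (one ∷ (Y :* (one :- monomial 6 4 0) :* (one :- monomial 8 4 0)) ∷ [])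
      base
      (q^0 ∷ ≈-trans (evenProduct-suc-suc M M)
        (*-cong (*-cong ≈-refl (1-q^-linear 6 4 0 m 0 (last-exp₁ m))) (1-q^-linear 8 4 0 m 0 (last-exp₂ m))) ∷ [])
      ≈-refl

  closedForm-edge : ∀ k → ClosedForm k → ClosedFormAt (suc k) (suc k) 0
  closedForm-edge k ih = ≈-trans regroup (≈-trans expand (≈-sym rhs))
    where
    linear-exp : ∀ k → suc (2 * k) ≡ 1 + 2 * k + 0 * 0
    linear-exp = ℕSolver.solve-∀
    γ-exp : ∀ k → 2 * suc (k + k) ≡ 2 + 4 * k + 0 * 0
    γ-exp = ℕSolver.solve-∀
    δ-exp : ∀ k → 2 * suc (suc (k + k)) ≡ 4 + 4 * k + 0 * 0
    δ-exp = ℕSolver.solve-∀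
    A = linearCoeff k
    B = constantCoeff k
    T₀ = tripleCoeff k k
    T₁ = tripleCoeff k (suc k)
    T₂ = tripleCoeff k (suc (suc k))
    Z = evenProduct (k + k)
    γ = 1-q^ (2 * suc (k + k))
    δ = 1-q^ (2 * suc (suc (k + k)))
    v : Fin 6 → Polynomial 6
    v i = var i
    regroup = prove-by-substitution
      ((v (# 0) :* v (# 2) :+ v (# 1) :* v (# 3) :+ v (# 0) :* v (# 4)) :* con 1ℤ :* v (# 5))
      (v (# 0) :* (v (# 2) :* con 1ℤ :* v (# 3)) :* (v (# 4) :* v (# 5)))
      (A ∷ B ∷ T₀ ∷ T₁ ∷ T₂ ∷ evenProduct (suc k + suc k) ∷ [])
      (v (# 0) ∷ v (# 1) ∷ v (# 2) ∷ con 0ℤ ∷ con 0ℤ ∷ (v (# 3) :* v (# 4) :* v (# 5)) ∷ [])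
      (A ∷ B ∷ T₀ ∷ Z ∷ γ ∷ δ ∷ [])
      (≈-refl ∷ ≈-refl ∷ ≈-refl ∷ ≈-trans (tripleCoeff-vanishes k (suc k) (ℕP.n<1+n k)) (≈-sym constₛ-0)
        ∷ ≈-trans (tripleCoeff-vanishes k (suc (suc k)) (ℕP.m≤n⇒m≤1+n (ℕP.n<1+n k))) (≈-sym constₛ-0)
        ∷ evenProduct-suc-suc k k ∷ [])
      ≈-refl
    q x u K Y one : Polynomial 5
    q = var (# 0)
    x = var (# 1)
    u = var (# 2)
    K = var (# 3)
    Y = var (# 4)
    one = con 1ℤ
    monomial : ℕ → ℕ → ℕ → Polynomial 5
    monomial a b c = q :^ a :* x :^ b :* u :^ c
    final : Polynomial 5
    final = (monomial 1 2 0 :* K) :* (Y :* (one :- monomial 2 4 0) :* (one :- monomial 4 4 0))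
    base : Vec Series 5
    base = q^ 1 ∷ q^ k ∷ q^ 0 ∷ q^ (k * k) ∷ evenProduct (k + k) ∷ []
    expand = prove-by-substitution
      (var (# 0) :* var (# 1) :* (var (# 2) :* var (# 3)))
      final
      (A ∷ T₀ *ₛ 1ₛ *ₛ Z ∷ γ ∷ δ ∷ [])
      (monomial 1 2 0 ∷ (K :* Y) ∷ (one :- monomial 2 4 0) ∷ (one :- monomial 4 4 0) ∷ [])
      base
      (q^-linear 1 2 0 k 0 (linear-exp k) ∷ ih k 0 (ℕP.+-identityʳ k)
       ∷ 1-q^-linear 2 4 0 k 0 (γ-exp k) ∷ 1-q^-linear 4 4 0 k 0 (δ-exp k) ∷ [])
      ≈-refl
    rhs = prove-by-substitution (var (# 0) :* var (# 1)) final
      (q^ (suc k * suc k) ∷ evenProduct (suc k + suc k) ∷ [])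
      ((monomial 1 2 0 :* K) ∷ (Y :* (one :- monomial 2 4 0) :* (one :- monomial 4 4 0)) ∷ [])
      base
      (q^-linear+square 1 2 0 k 0 (suc-square k 0) ∷ ≈-trans (evenProduct-suc-suc k k)
        (*-cong (*-cong ≈-refl (1-q^-linear 2 4 0 k 0 (γ-exp k))) (1-q^-linear 4 4 0 k 0 (δ-exp k))) ∷ [])
      ≈-refl

  closedForm-nearEdge : ∀ k → ClosedForm (suc k) → ClosedFormAt (suc (suc k)) (suc k) 1
  closedForm-nearEdge k ih = ≈-trans regroup (≈-trans expand (≈-sym rhs))
    where
    linear-exp : ∀ k → suc (2 * suc k) ≡ 3 + 2 * k + 0 * 0
    linear-exp = ℕSolver.solve-∀
    constant-exp : ∀ k → suc (2 * suc k) + suc (2 * suc k) ≡ 6 + 4 * k + 0 * 0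
    constant-exp = ℕSolver.solve-∀
    γ-exp : ∀ k → 2 * suc (k + suc k) ≡ 4 + 4 * k + 0 * 0
    γ-exp = ℕSolver.solve-∀
    δ-exp : ∀ k → 2 * suc (suc (k + suc k)) ≡ 6 + 4 * k + 0 * 0
    δ-exp = ℕSolver.solve-∀
    last-exp₁ : ∀ k → 2 * suc (suc k + suc k) ≡ 6 + 4 * k + 0 * 0
    last-exp₁ = ℕSolver.solve-∀
    last-exp₂ : ∀ k → 2 * suc (suc (suc k + suc k)) ≡ 8 + 4 * k + 0 * 0
    last-exp₂ = ℕSolver.solve-∀
    m = suc k
    A = linearCoeff m
    B = constantCoeff m
    T₀ = tripleCoeff m k
    T₁ = tripleCoeff m (suc k)
    T₂ = tripleCoeff m (suc (suc k))
    α = 1-q^ 2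
    Z = evenProduct (k + m)
    γ = 1-q^ (2 * suc (k + m))
    δ = 1-q^ (2 * suc (suc (k + m)))
    v : Fin 7 → Polynomial 7
    v i = var i
    v′ : Fin 8 → Polynomial 8
    v′ i = var i
    regroup = prove-by-substitution
      ((v (# 0) :* v (# 2) :+ v (# 1) :* v (# 3) :+ v (# 0) :* v (# 4)) :* (con 1ℤ :* v (# 5)) :* v (# 6))
      (v′ (# 0) :* (v′ (# 2) :* (con 1ℤ :* v′ (# 4)) :* v′ (# 5)) :* (v′ (# 6) :* v′ (# 7))
        :+ v′ (# 1) :* (v′ (# 3) :* con 1ℤ :* (v′ (# 5) :* v′ (# 6))) :* (v′ (# 4) :* v′ (# 7)))
      (A ∷ B ∷ T₀ ∷ T₁ ∷ T₂ ∷ α ∷ evenProduct (suc k + suc m) ∷ [])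
      (v′ (# 0) ∷ v′ (# 1) ∷ v′ (# 2) ∷ v′ (# 3) ∷ con 0ℤ ∷ v′ (# 4) ∷ (v′ (# 5) :* v′ (# 6) :* v′ (# 7)) ∷ [])
      (A ∷ B ∷ T₀ ∷ T₁ ∷ α ∷ Z ∷ γ ∷ δ ∷ [])
      (≈-refl ∷ ≈-refl ∷ ≈-refl ∷ ≈-refl ∷ ≈-trans (tripleCoeff-vanishes m (suc (suc k)) ℕP.≤-refl) (≈-sym constₛ-0)
        ∷ ≈-refl ∷ evenProduct-suc-suc k m ∷ [])
      ≈-refl
    q x u K Y one : Polynomial 5
    q = var (# 0)
    x = var (# 1)
    u = var (# 2)
    K = var (# 3)
    Y = var (# 4)
    one = con 1ℤ
    monomial : ℕ → ℕ → ℕ → Polynomial 5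
    monomial a b c = q :^ a :* x :^ b :* u :^ c
    final : Polynomial 5
    final = (monomial 1 2 0 :* K) :* (Y :* (one :- monomial 6 4 0) :* (one :- monomial 8 4 0))
    base : Vec Series 5
    base = q^ 1 ∷ q^ k ∷ q^ 0 ∷ q^ (k * k) ∷ evenProduct (m + m) ∷ []
    w : Fin 7 → Polynomial 7
    w i = var i
    expand = prove-by-substitution
      (w (# 0) :* w (# 2) :* (w (# 5) :* w (# 6)) :+ w (# 1) :* w (# 3) :* (w (# 4) :* w (# 6)))
      final
      (A ∷ B ∷ T₀ *ₛ (1ₛ *ₛ α) *ₛ Z ∷ T₁ *ₛ 1ₛ *ₛ (Z *ₛ γ) ∷ α ∷ γ ∷ δ ∷ [])
      (monomial 3 2 0 ∷ (one :+ monomial 6 4 0) ∷ (K :* Y) ∷ (monomial 1 2 0 :* K :* Y)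
        ∷ (one :- monomial 2 0 0) ∷ (one :- monomial 4 4 0) ∷ (one :- monomial 6 4 0) ∷ [])
      base
      (q^-linear 3 2 0 k 0 (linear-exp k) ∷ 1+q^-linear 6 4 0 k 0 (constant-exp k) ∷ ih k 1 (ℕP.+-comm k 1)
       ∷ ≈-trans (ih (suc k) 0 (cong suc (ℕP.+-identityʳ k))) (*-cong (q^-linear+square 1 2 0 k 0 (suc-square k 0)) ≈-refl)
       ∷ 1-q^-linear 2 0 0 k 0 refl ∷ 1-q^-linear 4 4 0 k 0 (γ-exp k) ∷ 1-q^-linear 6 4 0 k 0 (δ-exp k) ∷ [])
      ≈-refl
    rhs = prove-by-substitution (var (# 0) :* var (# 1)) final
      (q^ (suc k * suc k) ∷ evenProduct (suc m + suc m) ∷ [])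
      ((monomial 1 2 0 :* K) ∷ (Y :* (one :- monomial 6 4 0) :* (one :- monomial 8 4 0)) ∷ [])
      base
      (q^-linear+square 1 2 0 k 0 (suc-square k 0) ∷ ≈-trans (evenProduct-suc-suc m m)
        (*-cong (*-cong ≈-refl (1-q^-linear 6 4 0 k 0 (last-exp₁ k))) (1-q^-linear 8 4 0 k 0 (last-exp₂ k))) ∷ [])
      ≈-refl

  closedForm-interior : ∀ k d → ClosedForm (k + suc (suc d)) → ClosedFormAt (suc (k + suc (suc d))) (suc k) (suc (suc d))
  closedForm-interior k d ih = ≈-trans regroup (≈-trans expand (≈-sym rhs))
    where
    linear-exp : ∀ k d → suc (2 * (k + suc (suc d))) ≡ 5 + 2 * k + 2 * d
    linear-exp = ℕSolver.solve-∀
    constant-exp : ∀ k d → suc (2 * (k + suc (suc d))) + suc (2 * (k + suc (suc d))) ≡ 10 + 4 * k + 4 * d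
    constant-exp = ℕSolver.solve-∀
    suc-suc-square : ∀ k d → suc (suc k) * suc (suc k) ≡ 4 + 4 * k + 0 * d + k * k
    suc-suc-square = ℕSolver.solve-∀
    α-exp : ∀ k d → 2 * suc d ≡ 2 + 0 * k + 2 * d
    α-exp = ℕSolver.solve-∀
    β-exp : ∀ k d → 2 * suc (suc d) ≡ 4 + 0 * k + 2 * d
    β-exp = ℕSolver.solve-∀
    γ-exp : ∀ k d → 2 * suc (k + (k + suc (suc d))) ≡ 6 + 4 * k + 2 * d
    γ-exp = ℕSolver.solve-∀
    δ-exp : ∀ k d → 2 * suc (suc (k + (k + suc (suc d)))) ≡ 8 + 4 * k + 2 * d
    δ-exp = ℕSolver.solve-∀
    last-exp₁ : ∀ k d → 2 * suc ((k + suc (suc d)) + (k + suc (suc d))) ≡ 10 + 4 * k + 4 * d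
    last-exp₁ = ℕSolver.solve-∀
    last-exp₂ : ∀ k d → 2 * suc (suc ((k + suc (suc d)) + (k + suc (suc d)))) ≡ 12 + 4 * k + 4 * d
    last-exp₂ = ℕSolver.solve-∀
    m = k + suc (suc d)
    A = linearCoeff m
    B = constantCoeff m
    T₀ = tripleCoeff m k
    T₁ = tripleCoeff m (suc k)
    T₂ = tripleCoeff m (suc (suc k))
    P = evenProduct d
    α = 1-q^ (2 * suc d)
    β = 1-q^ (2 * suc (suc d))
    Z = evenProduct (k + m)
    γ = 1-q^ (2 * suc (k + m))
    δ = 1-q^ (2 * suc (suc (k + m)))
    regroup = prove-by-substitution
      ((var (# 0) :* var (# 2) :+ var (# 1) :* var (# 3) :+ var (# 0) :* var (# 4)) :* (var (# 5) :* var (# 6) :* var (# 7)) :* var (# 9))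
      (var (# 0) :* (var (# 2) :* (var (# 5) :* var (# 6) :* var (# 7)) :* var (# 8)) :* (var (# 9) :* var (# 10))
        :+ var (# 1) :* (var (# 3) :* (var (# 5) :* var (# 6)) :* (var (# 8) :* var (# 9))) :* (var (# 7) :* var (# 10))
        :+ var (# 0) :* (var (# 4) :* var (# 5) :* (var (# 8) :* var (# 9) :* var (# 10))) :* (var (# 6) :* var (# 7)))
      (A ∷ B ∷ T₀ ∷ T₁ ∷ T₂ ∷ P ∷ α ∷ β ∷ Z ∷ evenProduct (suc k + suc m) ∷ γ ∷ δ ∷ [])
      (var (# 0) ∷ var (# 1) ∷ var (# 2) ∷ var (# 3) ∷ var (# 4) ∷ var (# 5) ∷ var (# 6) ∷ var (# 7) ∷ var (# 8)
        ∷ (var (# 8) :* var (# 9) :* var (# 10)) ∷ var (# 9) ∷ var (# 10) ∷ [])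
      (A ∷ B ∷ T₀ ∷ T₁ ∷ T₂ ∷ P ∷ α ∷ β ∷ Z ∷ γ ∷ δ ∷ [])
      (≈-refl ∷ ≈-refl ∷ ≈-refl ∷ ≈-refl ∷ ≈-refl ∷ ≈-refl ∷ ≈-refl ∷ ≈-refl ∷ ≈-refl
        ∷ evenProduct-suc-suc k m ∷ ≈-refl ∷ ≈-refl ∷ [])
      ≈-refl
    q x u K Y one : Polynomial 5
    q = var (# 0)
    x = var (# 1)
    u = var (# 2)
    K = var (# 3)
    Y = var (# 4)
    one = con 1ℤ
    monomial : ℕ → ℕ → ℕ → Polynomial 5
    monomial a b c = q :^ a :* x :^ b :* u :^ c
    final : Polynomial 5
    final = (monomial 1 2 0 :* K) :* (Y :* (one :- monomial 10 4 4) :* (one :- monomial 12 4 4))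
    base : Vec Series 5
    base = q^ 1 ∷ q^ k ∷ q^ d ∷ q^ (k * k) ∷ evenProduct (m + m) ∷ []
    expand = prove-by-substitution
      (var (# 0) :* var (# 2) :* (var (# 7) :* var (# 8)) :+ var (# 1) :* var (# 3) :* (var (# 6) :* var (# 8))
        :+ var (# 0) :* var (# 4) :* (var (# 5) :* var (# 6)))
      final
      (A ∷ B ∷ T₀ *ₛ (P *ₛ α *ₛ β) *ₛ Z ∷ T₁ *ₛ (P *ₛ α) *ₛ (Z *ₛ γ) ∷ T₂ *ₛ P *ₛ (Z *ₛ γ *ₛ δ)
        ∷ α ∷ β ∷ γ ∷ δ ∷ [])
      (monomial 5 2 2 ∷ (one :+ monomial 10 4 4) ∷ (K :* Y) ∷ (monomial 1 2 0 :* K :* Y) ∷ (monomial 4 4 0 :* K :* Y)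
        ∷ (one :- monomial 2 0 2) ∷ (one :- monomial 4 0 2) ∷ (one :- monomial 6 4 2) ∷ (one :- monomial 8 4 2) ∷ [])
      base
      (q^-linear 5 2 2 k d (linear-exp k d) ∷ 1+q^-linear 10 4 4 k d (constant-exp k d) ∷ ih k (suc (suc d)) refl
       ∷ ≈-trans (ih (suc k) (suc d) (sym (ℕP.+-suc k (suc d))))
                 (*-cong (q^-linear+square 1 2 0 k d (suc-square k d)) ≈-refl)
       ∷ ≈-trans (ih (suc (suc k)) d (sym (trans (ℕP.+-suc k (suc d)) (cong suc (ℕP.+-suc k d)))))
                 (*-cong (q^-linear+square 4 4 0 k d (suc-suc-square k d)) ≈-refl)
       ∷ 1-q^-linear 2 0 2 k d (α-exp k d) ∷ 1-q^-linear 4 0 2 k d (β-exp k d)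
       ∷ 1-q^-linear 6 4 2 k d (γ-exp k d) ∷ 1-q^-linear 8 4 2 k d (δ-exp k d) ∷ [])
      ≈-refl
    rhs = prove-by-substitution (var (# 0) :* var (# 1)) final
      (q^ (suc k * suc k) ∷ evenProduct (suc m + suc m) ∷ [])
      ((monomial 1 2 0 :* K) ∷ (Y :* (one :- monomial 10 4 4) :* (one :- monomial 12 4 4)) ∷ [])
      base
      (q^-linear+square 1 2 0 k d (suc-square k d) ∷ ≈-trans (evenProduct-suc-suc m m)
        (*-cong (*-cong ≈-refl (1-q^-linear 10 4 4 k d (last-exp₁ k d))) (1-q^-linear 12 4 4 k d (last-exp₂ k d))) ∷ [])
      ≈-refl

  closedForm : ∀ m → ClosedForm m
  closedForm zero zero zero refl = closedForm-zero
  closedForm (suc m) zero .(suc m) refl = closedForm-centre m (closedForm m)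
  closedForm (suc m) (suc k) zero eq
    with trans (sym (ℕP.+-identityʳ k)) (ℕP.suc-injective eq)
  ... | refl = closedForm-edge k (closedForm k)
  closedForm (suc m) (suc k) (suc zero) eq
    with trans (sym (ℕP.+-comm k 1)) (ℕP.suc-injective eq)
  ... | refl = closedForm-nearEdge k (closedForm (suc k))
  closedForm (suc .(k + suc (suc d))) (suc k) (suc (suc d)) refl = closedForm-interior k d (closedForm _)

module GaussIdentity where

  open import Data.Nat as ℕ using (ℕ; zero; suc; _+_; _*_; _∸_; _≤_; _<_)
  import Data.Nat.Properties as ℕP
  open import Data.Integer as ℤ using (ℤ; 1ℤ)
  open import Data.Vec using (Vec; []; _∷_)
  open import Data.Vec.Relation.Binary.Pointwise.Inductive using ([]; _∷_)
  open import Data.Fin using (#_)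
  open import Function using (_∘_)
  open import Relation.Binary.PropositionalEquality
  open FormalPowerSeries
  open TripleProduct
  open ≈-Reasoning

  evenProductInv : ℕ → Series
  evenProductInv = product (λ i → geometric (2 * suc i))

  oddProductInv : ℕ → Series
  oddProductInv = product (λ i → geometric (suc (2 * i)))

  evenProduct-inverse : ∀ a → evenProduct a *ₛ evenProductInv a ≈ 1ₛ
  evenProduct-inverse a = ≈-trans (product-* _ _ a) (product-≈1 _ a (λ i → 1-q^-*-geometric (i + suc (i + 0))))

  oddProduct-inverse : ∀ a → oddProduct a *ₛ oddProductInv a ≈ 1ₛ
  oddProduct-inverse a = ≈-trans (product-* _ _ a) (product-≈1 _ a (λ i → 1-q^-*-geometric (2 * i)))

  tripleCoeff-closedForm : ∀ m k → k ≤ m →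
    tripleCoeff m k ≈ q^ (k * k) *ₛ evenProduct (m + m) *ₛ evenProductInv (m ∸ k) *ₛ evenProductInv (k + m)
  tripleCoeff-closedForm m k k≤m = begin
      tripleCoeff m k
    ≈⟨ solve 1 (λ t → t := t :* con 1ℤ :* con 1ℤ) ≈-refl (tripleCoeff m k) ⟩
      tripleCoeff m k *ₛ 1ₛ *ₛ 1ₛ
    ≈⟨ ≈-sym (*-cong (*-cong ≈-refl (evenProduct-inverse d)) (evenProduct-inverse (k + m))) ⟩
      tripleCoeff m k *ₛ (evenProduct d *ₛ evenProductInv d) *ₛ (evenProduct (k + m) *ₛ evenProductInv (k + m))
    ≈⟨ solve 5 (λ t a b c e → t :* (a :* b) :* (c :* e) := t :* a :* c :* b :* e) ≈-refl
         (tripleCoeff m k) (evenProduct d) (evenProductInv d) (evenProduct (k + m)) (evenProductInv (k + m)) ⟩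
      tripleCoeff m k *ₛ evenProduct d *ₛ evenProduct (k + m) *ₛ evenProductInv d *ₛ evenProductInv (k + m)
    ≈⟨ *-cong (*-cong (closedForm m k d (ℕP.m+[n∸m]≡n k≤m)) ≈-refl) ≈-refl ⟩
      q^ (k * k) *ₛ evenProduct (m + m) *ₛ evenProductInv d *ₛ evenProductInv (k + m)
    ∎
    where d = m ∸ k

  overpartitionProduct : ℕ → Series
  overpartitionProduct = product (λ i → 1+q^ suc i *ₛ geometric (suc i))

  -- The two new even factors (1 - q^(4m+2)) (1 - q^(4m+4))
  -- = (1 - q^(2m+1)) (1 + q^(2m+1)) (1 - q^(2m+2)) (1 + q^(2m+2)).
  evenProduct-doubling-step : ∀ m →
    1-q^ (2 * suc (m + m)) *ₛ 1-q^ (2 * suc (suc (m + m))) *ₛ geometric (suc (2 * m)) *ₛ geometric (suc (2 * m))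
      ≈ (1+q^ suc (m + m) *ₛ geometric (suc (m + m))) *ₛ (1+q^ suc (suc (m + m)) *ₛ geometric (suc (suc (m + m))))
          *ₛ 1-q^ (2 * suc m) *ₛ 1-q^ (2 * suc m)
  evenProduct-doubling-step m =
    ≈-trans lhs (≈-trans (*-cong ≈-refl (1-q^-*-geometric (m + m)))
      (≈-sym (≈-trans rhs (*-cong ≈-refl (1-q^-*-geometric (suc (m + m)))))))
    where
    x y gx gy one C : Polynomial 4
    x = var (# 0)
    y = var (# 1)
    gx = var (# 2)
    gy = var (# 3)
    one = con 1ℤ
    C = (one :+ x) :* (one :+ y) :* (one :- y) :* gx
    base : Vec Series 4
    base = q^ suc (m + m) ∷ q^ suc (suc (m + m)) ∷ geometric (suc (m + m)) ∷ geometric (suc (suc (m + m))) ∷ []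
    2*≡+ : ∀ a → 2 * a ≡ a + a
    2*≡+ a = cong (a +_) (ℕP.+-identityʳ a)
    q^-double : ∀ a → q^ (2 * a) ≈ q^ a *ₛ q^ a
    q^-double a = ≈-trans (≈-reflexive (cong q^_ (2*≡+ a))) (q^-+ a a)
    lhs = prove-by-substitution (var (# 0) :* var (# 1) :* var (# 2) :* var (# 2)) (C :* ((one :- x) :* gx))
      (1-q^ (2 * suc (m + m)) ∷ 1-q^ (2 * suc (suc (m + m))) ∷ geometric (suc (2 * m)) ∷ [])
      ((one :- x :* x) ∷ (one :- y :* y) ∷ gx ∷ [])
      base
      (+-cong ≈-refl (-‿cong (q^-double (suc (m + m)))) ∷ +-cong ≈-refl (-‿cong (q^-double (suc (suc (m + m)))))
        ∷ ≈-reflexive (cong (geometric ∘ suc) (2*≡+ m)) ∷ [])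
      ≈-refl
    rhs = prove-by-substitution (var (# 0) :* var (# 1) :* var (# 2) :* var (# 2)) (C :* ((one :- y) :* gy))
      ((1+q^ suc (m + m) *ₛ geometric (suc (m + m))) ∷ (1+q^ suc (suc (m + m)) *ₛ geometric (suc (suc (m + m))))
        ∷ 1-q^ (2 * suc m) ∷ [])
      (((one :+ x) :* gx) ∷ ((one :+ y) :* gy) ∷ (one :- y) ∷ [])
      base
      (≈-refl ∷ ≈-refl
        ∷ +-cong ≈-refl (-‿cong (≈-reflexive (cong q^_ (trans (2*≡+ (suc m)) (cong suc (ℕP.+-suc m m)))))) ∷ [])
      ≈-refl

  evenProduct-doubling : ∀ m → evenProduct (m + m) *ₛ oddProductInv m *ₛ oddProductInv m
                             ≈ overpartitionProduct (m + m) *ₛ evenProduct m *ₛ evenProduct m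
  evenProduct-doubling zero = ≈-refl
  evenProduct-doubling (suc m) = begin
      evenProduct (suc m + suc m) *ₛ (oddProductInv m *ₛ g) *ₛ (oddProductInv m *ₛ g)
    ≈⟨ *-cong (*-cong (evenProduct-suc-suc m m) ≈-refl) ≈-refl ⟩
      evenProduct (m + m) *ₛ e₁ *ₛ e₂ *ₛ (oddProductInv m *ₛ g) *ₛ (oddProductInv m *ₛ g)
    ≈⟨ solve 5 (λ Q a b V g → Q :* a :* b :* (V :* g) :* (V :* g) := (Q :* V :* V) :* (a :* b :* g :* g)) ≈-refl
         (evenProduct (m + m)) e₁ e₂ (oddProductInv m) g ⟩
      (evenProduct (m + m) *ₛ oddProductInv m *ₛ oddProductInv m) *ₛ (e₁ *ₛ e₂ *ₛ g *ₛ g)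
    ≈⟨ *-cong (evenProduct-doubling m) (evenProduct-doubling-step m) ⟩
      (overpartitionProduct (m + m) *ₛ evenProduct m *ₛ evenProduct m) *ₛ (f₁ *ₛ f₂ *ₛ o *ₛ o)
    ≈⟨ solve 5 (λ G Q a b o → (G :* Q :* Q) :* (a :* b :* o :* o) := G :* a :* b :* (Q :* o) :* (Q :* o)) ≈-refl
         (overpartitionProduct (m + m)) (evenProduct m) f₁ f₂ o ⟩
      overpartitionProduct (m + m) *ₛ f₁ *ₛ f₂ *ₛ (evenProduct m *ₛ o) *ₛ (evenProduct m *ₛ o)
    ≈⟨ ≈-reflexive (cong (λ i → overpartitionProduct i *ₛ (evenProduct m *ₛ o) *ₛ (evenProduct m *ₛ o))
                         (cong suc (sym (ℕP.+-suc m m)))) ⟩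
      overpartitionProduct (suc m + suc m) *ₛ (evenProduct m *ₛ o) *ₛ (evenProduct m *ₛ o)
    ∎
    where
    g = geometric (suc (2 * m))
    e₁ = 1-q^ (2 * suc (m + m))
    e₂ = 1-q^ (2 * suc (suc (m + m)))
    f₁ = 1+q^ suc (m + m) *ₛ geometric (suc (m + m))
    f₂ = 1+q^ suc (suc (m + m)) *ₛ geometric (suc (suc (m + m)))
    o = 1-q^ (2 * suc m)

  -- [2m choose m - k] (in base q²) divided by [2m choose m].
  binomialRatio : ℕ → ℕ → Series
  binomialRatio m k = evenProduct m *ₛ evenProduct m *ₛ evenProductInv (m ∸ k) *ₛ evenProductInv (k + m)

  foldedSum-cong : ∀ F F' L → (∀ k → k ≤ L → F k ≈ F' k) → foldedSum F L ≈ foldedSum F' L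
  foldedSum-cong F F' zero h = h 0 ℕ.z≤n
  foldedSum-cong F F' (suc L) h =
    +-cong (foldedSum-cong F F' L (λ k l → h k (ℕP.m≤n⇒m≤1+n l))) (*-cong ≈-refl (h (suc L) ℕP.≤-refl))

  foldedSum-* : ∀ F L W → foldedSum F L *ₛ W ≈ foldedSum (λ k → F k *ₛ W) L
  foldedSum-* F zero W = ≈-refl
  foldedSum-* F (suc L) W = ≈-trans (distribʳ W _ _) (+-cong (foldedSum-* F L W) (*-assoc _ _ _))

  tripleCoeff-oddProductInv² : ∀ m k → k ≤ m →
    tripleCoeff m k *ₛ (oddProductInv m *ₛ oddProductInv m) ≈ q^ (k * k) *ₛ overpartitionProduct (m + m) *ₛ binomialRatio m k
  tripleCoeff-oddProductInv² m k k≤m = begin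
      tripleCoeff m k *ₛ (V *ₛ V)
    ≈⟨ *-cong (tripleCoeff-closedForm m k k≤m) ≈-refl ⟩
      K *ₛ evenProduct (m + m) *ₛ I₁ *ₛ I₂ *ₛ (V *ₛ V)
    ≈⟨ solve 6 (λ K Q a b V W → K :* Q :* a :* b :* (V :* W) := K :* (Q :* V :* W) :* (a :* b)) ≈-refl
         K (evenProduct (m + m)) I₁ I₂ V V ⟩
      K *ₛ (evenProduct (m + m) *ₛ V *ₛ V) *ₛ (I₁ *ₛ I₂)
    ≈⟨ *-cong (*-cong ≈-refl (evenProduct-doubling m)) ≈-refl ⟩
      K *ₛ (overpartitionProduct (m + m) *ₛ evenProduct m *ₛ evenProduct m) *ₛ (I₁ *ₛ I₂)
    ≈⟨ solve 6 (λ K G Q₁ Q₂ a b → K :* (G :* Q₁ :* Q₂) :* (a :* b) := K :* G :* (Q₁ :* Q₂ :* a :* b)) ≈-refl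
         K (overpartitionProduct (m + m)) (evenProduct m) (evenProduct m) I₁ I₂ ⟩
      K *ₛ overpartitionProduct (m + m) *ₛ binomialRatio m k
    ∎
    where
    K = q^ (k * k)
    V = oddProductInv m
    I₁ = evenProductInv (m ∸ k)
    I₂ = evenProductInv (k + m)

  foldedSum-gauss : ∀ m → foldedSum (λ k → q^ (k * k) *ₛ overpartitionProduct (m + m) *ₛ binomialRatio m k) m ≈ 1ₛ
  foldedSum-gauss m = begin
      foldedSum (λ k → q^ (k * k) *ₛ overpartitionProduct (m + m) *ₛ binomialRatio m k) m
    ≈⟨ ≈-sym (foldedSum-cong _ _ m (tripleCoeff-oddProductInv² m)) ⟩
      foldedSum (λ k → tripleCoeff m k *ₛ (V *ₛ V)) m
    ≈⟨ ≈-sym (foldedSum-* (tripleCoeff m) m (V *ₛ V)) ⟩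
      foldedSum (tripleCoeff m) m *ₛ (V *ₛ V)
    ≈⟨ *-cong (foldedSum-tripleCoeff m) ≈-refl ⟩
      oddProduct m *ₛ oddProduct m *ₛ (V *ₛ V)
    ≈⟨ solve 2 (λ O V → O :* O :* (V :* V) := (O :* V) :* (O :* V)) ≈-refl (oddProduct m) V ⟩
      (oddProduct m *ₛ V) *ₛ (oddProduct m *ₛ V)
    ≈⟨ *-cong (oddProduct-inverse m) (oddProduct-inverse m) ⟩
      1ₛ *ₛ 1ₛ
    ≈⟨ *-identityˡ 1ₛ ⟩
      1ₛ
    ∎
    where V = oddProductInv m

  evenProduct-ratio-≈[]1ˡ : ∀ a j → evenProduct (j + a) *ₛ evenProductInv a ≈[ 2 * suc a ] 1ₛ
  evenProduct-ratio-≈[]1ˡ a zero = ≈⇒≈[] (evenProduct-inverse a)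
  evenProduct-ratio-≈[]1ˡ a (suc j) =
    ≈[]-trans (≈⇒≈[] (solve 3 (λ Q o I → Q :* o :* I := (Q :* I) :* o) ≈-refl
                               (evenProduct (j + a)) (1-q^ (2 * suc (j + a))) (evenProductInv a)))
      (*-≈[]1 (evenProduct-ratio-≈[]1ˡ a j)
              (≈[]-weaken (ℕP.*-monoʳ-≤ 2 (ℕ.s≤s (ℕP.m≤n+m a j))) (1-q^-≈[]1 (2 * suc (j + a)))))

  evenProduct-ratio-≈[]1ʳ : ∀ a j → evenProduct a *ₛ evenProductInv (j + a) ≈[ 2 * suc a ] 1ₛ
  evenProduct-ratio-≈[]1ʳ a zero = ≈⇒≈[] (evenProduct-inverse a)
  evenProduct-ratio-≈[]1ʳ a (suc j) =
    ≈[]-trans (≈⇒≈[] (≈-sym (*-assoc (evenProduct a) (evenProductInv (j + a)) (geometric (2 * suc (j + a))))))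
      (*-≈[]1 (evenProduct-ratio-≈[]1ʳ a j)
              (≈[]-weaken (ℕP.*-monoʳ-≤ 2 (ℕ.s≤s (ℕP.m≤n+m a j))) (geometric-≈[]1 _)))

  binomialRatio-≈[]1 : ∀ m k → k ≤ m → binomialRatio m k ≈[ 2 * suc (m ∸ k) ] 1ₛ
  binomialRatio-≈[]1 m k k≤m = ≈[]-trans (≈⇒≈[] regroup)
    (*-≈[]1 lower (≈[]-weaken (ℕP.*-monoʳ-≤ 2 (ℕ.s≤s (ℕP.m∸n≤m m k))) (evenProduct-ratio-≈[]1ʳ m k)))
    where
    regroup : binomialRatio m k ≈ (evenProduct m *ₛ evenProductInv (m ∸ k)) *ₛ (evenProduct m *ₛ evenProductInv (k + m))
    regroup = solve 4 (λ Q a b c → Q :* Q :* a :* b := (Q :* a) :* (Q :* b)) ≈-refl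
      (evenProduct m) (evenProductInv (m ∸ k)) (evenProductInv (k + m)) (evenProduct m)
    lower : evenProduct m *ₛ evenProductInv (m ∸ k) ≈[ 2 * suc (m ∸ k) ] 1ₛ
    lower = ≈[]-trans (≈⇒≈[] (*-cong (≈-reflexive (cong evenProduct (sym (ℕP.m+[n∸m]≡n k≤m)))) ≈-refl))
                      (evenProduct-ratio-≈[]1ˡ (m ∸ k) k)

  foldedSumℤ : (ℕ → ℤ) → ℕ → ℤ
  foldedSumℤ a zero = a 0
  foldedSumℤ a (suc L) = foldedSumℤ a L ℤ.+ foldedSign (suc L) ℤ.* a (suc L)

  foldedSum-coeff : ∀ F L n → foldedSum F L n ≡ foldedSumℤ (λ k → F k n) L
  foldedSum-coeff F zero n = refl
  foldedSum-coeff F (suc L) n = trans (+ₛ-coeff (foldedSum F L) _ n)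
    (cong₂ ℤ._+_ (foldedSum-coeff F L n) (constₛ-*-coeff (foldedSign (suc L)) (F (suc L)) n))

  foldedSumℤ-cong : ∀ a b L → (∀ k → k ≤ L → a k ≡ b k) → foldedSumℤ a L ≡ foldedSumℤ b L
  foldedSumℤ-cong a b zero h = h 0 ℕ.z≤n
  foldedSumℤ-cong a b (suc L) h = cong₂ ℤ._+_ (foldedSumℤ-cong a b L (λ k l → h k (ℕP.m≤n⇒m≤1+n l)))
    (cong (foldedSign (suc L) ℤ.*_) (h (suc L) ℕP.≤-refl))

  square-bound : ∀ k d → k + d < k * k + 2 * suc d
  square-bound zero d = ℕ.s≤s (ℕP.m≤m+n d (suc d + 0))
  square-bound (suc k) d = ℕP.<-≤-trans (ℕP.+-monoʳ-< (suc k) (ℕP.n<1+n d))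
    (ℕP.+-mono-≤ (ℕP.m≤m+n (suc k) (k * suc k)) (ℕP.m≤m+n (suc d) (suc d + 0)))

  -- In degrees n ≤ m the factor binomialRatio m k is invisible: it is 1 up to degree 2(m-k)+1
  -- and is multiplied by q^(k²).
  gauss-term-coeff : ∀ m k n → k ≤ m → n ≤ m →
    (q^ (k * k) *ₛ overpartitionProduct (m + m) *ₛ binomialRatio m k) n ≡ (q^ (k * k) *ₛ overpartitionProduct (m + m)) n
  gauss-term-coeff m k n k≤m n≤m =
    trans (coeff (*-assoc (q^ (k * k)) G (binomialRatio m k)) n)
      (trans (coeff (q^-*-shift (k * k) _) n)
        (trans (shift-≈[] (k * k) G-≈[] n bound) (sym (coeff (q^-*-shift (k * k) _) n))))
    where
    G = overpartitionProduct (m + m)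
    G-≈[] : G *ₛ binomialRatio m k ≈[ 2 * suc (m ∸ k) ] G
    G-≈[] = ≈[]-trans (*-≈[] (λ _ _ → refl) (binomialRatio-≈[]1 m k k≤m)) (≈⇒≈[] (≈-trans (*-comm _ _) (*-identityˡ _)))
    bound : n < k * k + 2 * suc (m ∸ k)
    bound = ℕP.≤-<-trans (ℕP.≤-trans n≤m (ℕP.≤-reflexive (sym (ℕP.m+[n∸m]≡n k≤m)))) (square-bound k (m ∸ k))

  gauss-coeff : ∀ n → foldedSumℤ (λ k → (q^ (k * k) *ₛ overpartitionProduct (n + n)) n) n ≡ 1ₛ n
  gauss-coeff n = trans (sym (foldedSumℤ-cong _ _ n (λ k k≤n → gauss-term-coeff n k n k≤n ℕP.≤-refl)))
    (trans (sym (foldedSum-coeff (λ k → q^ (k * k) *ₛ overpartitionProduct (n + n) *ₛ binomialRatio n k) n n))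
           (coeff (foldedSum-gauss n) n))

module Enumeration where

  open import Data.Nat using (zero; suc; _∸_; _≤_; z≤n; s≤s)
  import Data.Nat.Properties as ℕP
  open import Data.List using (List; []; _∷_; length; lookup)
  open import Data.List.Membership.Propositional using (_∈_)
  open import Data.List.Membership.Propositional.Properties using (∈-lookup)
  open import Data.List.Relation.Unary.Any using (here; there; index)
  open import Data.List.Relation.Unary.Any.Properties using (lookup-index)
  open import Data.List.Relation.Unary.Unique.Propositional using (Unique)
  open import Data.List.Relation.Unary.AllPairs using ([]; _∷_)
  import Data.List.Relation.Unary.All as All
  open import Data.Fin using (Fin; zero; suc)
  open import Data.Product using (Σ; _,_)
  open import Function.Bundles using (_↔_; mk↔ₛ′; _⇔_; Equivalence)
  open import Relation.Binary.PropositionalEquality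
  open import Data.Empty using (⊥-elim)

  index-∈-lookup : ∀ {A : Set} {L : List A} → Unique L → ∀ i (p : lookup L i ∈ L) → index p ≡ i
  index-∈-lookup {L = x ∷ xs} (x∉xs ∷ u) zero (here eq) = refl
  index-∈-lookup {L = x ∷ xs} (x∉xs ∷ u) zero (there p) = ⊥-elim (All.lookup x∉xs p refl)
  index-∈-lookup {L = x ∷ xs} (x∉xs ∷ u) (suc i) (here eq) = ⊥-elim (All.lookup x∉xs (∈-lookup i) (sym eq))
  index-∈-lookup {L = x ∷ xs} (x∉xs ∷ u) (suc i) (there p) = cong suc (index-∈-lookup u i p)

  enumeration : ∀ {A : Set} (P : A → Set) (L : List A) → Unique L → (∀ x → (x ∈ L) ⇔ P x) →
                (∀ x (p q : P x) → p ≡ q) → Fin (length L) ↔ Σ A P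
  enumeration P L u h irr = mk↔ₛ′ to from to∘from from∘to
    where
    to : Fin (length L) → Σ _ P
    to i = lookup L i , Equivalence.to (h (lookup L i)) (∈-lookup i)
    from : Σ _ P → Fin (length L)
    from (x , p) = index (Equivalence.from (h x) p)
    from∘to : ∀ i → from (to i) ≡ i
    from∘to i = index-∈-lookup u i _
    to∘from : ∀ y → to (from y) ≡ y
    to∘from (x , p) = pair-≡ (sym (lookup-index (Equivalence.from (h x) p))) _ p
      where
      pair-≡ : ∀ {x'} → x' ≡ x → (p' : P x') (p : P x) → (x' , p') ≡ (x , p)
      pair-≡ refl p' p = cong (x ,_) (irr x p' p)

  -- The enumerations below recurse on n ∸ suc Q, so they carry a fuel bound f ≥ n.
  fuel-∸ : ∀ n f Q → n ≤ suc f → n ∸ suc Q ≤ f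
  fuel-∸ zero f Q _ = z≤n
  fuel-∸ (suc n) f Q (s≤s l) = ℕP.≤-trans (ℕP.m∸n≤m n Q) l

module Overpartitions where

  open import Defs
  open import Data.Nat as ℕ using (ℕ; zero; suc; _≤?_; _∸_; _+_; _<_; _≤_; s≤s; z≤n)
  import Data.Nat.Properties as ℕP
  open import Data.Bool using (Bool; true; false)
  import Data.Bool.Properties as BoolP
  open import Data.Product using (Σ; _×_; _,_; proj₁)
  open import Data.Sum using (_⊎_; inj₁; inj₂)
  open import Data.List using (List; []; _∷_; map; _++_; length)
  open import Data.List.Properties using (∷-injectiveʳ; ∷-injectiveˡ)
  open import Data.Nat.ListAction using (sum)
  import Data.List.Relation.Unary.All as All
  open import Data.List.Relation.Unary.All using (All; _∷_)
  import Data.List.Relation.Unary.Linked as Linked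
  open import Data.List.Relation.Unary.Linked using (Linked; [-]; _∷_)
  open import Data.List.Membership.Propositional using (_∈_)
  open import Data.List.Membership.Propositional.Properties using (∈-map⁺; ∈-map⁻; ∈-++⁺ˡ; ∈-++⁺ʳ; ∈-++⁻)
  open import Data.List.Relation.Unary.Any using (here)
  open import Data.List.Relation.Unary.Unique.Propositional using (Unique)
  import Data.List.Relation.Unary.Unique.Propositional.Properties as Unique
  open import Data.List.Relation.Unary.AllPairs using ([]; _∷_)
  open import Data.Fin using (Fin)
  open import Function.Bundles using (_↔_; _⇔_; mk⇔)
  open import Relation.Nullary using (yes; no; Dec; ¬_)
  open import Relation.Binary.PropositionalEquality
  open import Axiom.UniquenessOfIdentityProofs using (module Decidable⇒UIP)
  open import Data.Empty using (⊥-elim)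
  open Enumeration

  IsOverpartition : ℕ → List Part → Set
  IsOverpartition n xs = All (λ pt → 1 ≤ proj₁ pt) xs × Linked OrdStep xs × (sum (map proj₁ xs) ≡ n)

  -- Overpartitions of n that may follow an overlined part suc P: all parts are at most suc P,
  -- and parts equal to suc P are not overlined.
  AfterOverlined : ℕ → ℕ → List Part → Set
  AfterOverlined P n xs =
    All (λ pt → 1 ≤ proj₁ pt) xs × Linked OrdStep ((suc P , true) ∷ xs) × (sum (map proj₁ xs) ≡ n)

  prependBoth : ∀ {Q n : ℕ} → Dec (suc Q ≤ n) → List (List Part) → List (List Part)
  prependBoth {Q} (yes _) L = map ((suc Q , true) ∷_) L ++ map ((suc Q , false) ∷_) L
  prependBoth (no _) L = []

  prependPlain : ∀ {P n : ℕ} → Dec (suc P ≤ n) → List (List Part) → List (List Part)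
  prependPlain {P} (yes _) L = map ((suc P , false) ∷_) L
  prependPlain (no _) L = []

  -- afterOverlined f P n lists the solutions of AfterOverlined P n (for n ≤ f) by their first part:
  -- a smaller part (either overlined or not) from largestAtMost, or a plain part suc P.
  afterOverlined : ℕ → ℕ → ℕ → List (List Part)
  largestAtMost : ℕ → ℕ → ℕ → List (List Part)

  afterOverlined f P zero = [] ∷ []
  afterOverlined zero P (suc n) = []
  afterOverlined (suc f) P (suc n) =
    largestAtMost f (suc n) P ++ prependPlain {P} {suc n} (suc P ≤? suc n) (afterOverlined f P (suc n ∸ suc P))

  largestAtMost f n zero = []
  largestAtMost f n (suc Q) =
    largestAtMost f n Q ++ prependBoth {Q} {n} (suc Q ≤? n) (afterOverlined f Q (n ∸ suc Q))

  afterOverlined-fuel : ∀ f f' P n → n ≤ f → n ≤ f' → afterOverlined f P n ≡ afterOverlined f' P n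
  largestAtMost-fuel : ∀ f f' n Q → n ≤ suc f → n ≤ suc f' → largestAtMost f n Q ≡ largestAtMost f' n Q

  afterOverlined-fuel f f' P zero _ _ = refl
  afterOverlined-fuel (suc f) (suc f') P (suc n) l l' =
    cong₂ _++_ (largestAtMost-fuel f f' (suc n) P l l')
      (cong (prependPlain (suc P ≤? suc n))
            (afterOverlined-fuel f f' P (suc n ∸ suc P) (fuel-∸ (suc n) f P l) (fuel-∸ (suc n) f' P l')))

  largestAtMost-fuel f f' n zero l l' = refl
  largestAtMost-fuel f f' n (suc Q) l l' =
    cong₂ _++_ (largestAtMost-fuel f f' n Q l l')
      (cong (prependBoth (suc Q ≤? n)) (afterOverlined-fuel f f' Q (n ∸ suc Q) (fuel-∸ n f Q l) (fuel-∸ n f' Q l')))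

  Linked-reoverline : ∀ {p b b'} xs → Linked OrdStep ((p , b) ∷ xs) → Linked OrdStep ((p , b') ∷ xs)
  Linked-reoverline [] _ = [-]
  Linked-reoverline (x ∷ xs) (r ∷ l) = r ∷ l

  AfterOverlined-∷ : ∀ P Q b n ys → Q < P ⊎ (Q ≡ P × b ≡ false) → suc Q ≤ n →
                     AfterOverlined Q (n ∸ suc Q) ys → AfterOverlined P n ((suc Q , b) ∷ ys)
  AfterOverlined-∷ P Q b n ys st le (a , l , s) =
    (s≤s z≤n ∷ a) , (step st ∷ Linked-reoverline ys l) , trans (cong (suc Q +_) s) (ℕP.m+[n∸m]≡n le)
    where
    step : Q < P ⊎ (Q ≡ P × b ≡ false) → OrdStep (suc P , true) (suc Q , b)
    step (inj₁ q<p) = inj₁ (s≤s q<p)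
    step (inj₂ (refl , refl)) = inj₂ (refl , refl)

  afterOverlined-sound : ∀ f P n xs → xs ∈ afterOverlined f P n → AfterOverlined P n xs
  largestAtMost-sound : ∀ f n Q P xs → Q ≤ P → xs ∈ largestAtMost f n Q → AfterOverlined P n xs

  afterOverlined-sound f P zero .[] (here refl) = All.[] , [-] , refl
  afterOverlined-sound (suc f) P (suc n) xs m with ∈-++⁻ (largestAtMost f (suc n) P) m
  ... | inj₁ m₁ = largestAtMost-sound f (suc n) P P xs ℕP.≤-refl m₁
  ... | inj₂ m₂ with suc P ≤? suc n
  ...   | yes le with ∈-map⁻ ((suc P , false) ∷_) m₂
  ...     | ys , m₃ , refl =
    AfterOverlined-∷ P P false (suc n) ys (inj₂ (refl , refl)) le (afterOverlined-sound f P (suc n ∸ suc P) ys m₃)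

  largestAtMost-sound f n (suc Q) P xs le m with ∈-++⁻ (largestAtMost f n Q) m
  ... | inj₁ m₁ = largestAtMost-sound f n Q P xs (ℕP.<⇒≤ le) m₁
  ... | inj₂ m₂ with suc Q ≤? n
  ...   | yes sle with ∈-++⁻ (map ((suc Q , true) ∷_) (afterOverlined f Q (n ∸ suc Q))) m₂
  ...     | inj₁ m₃ with ∈-map⁻ ((suc Q , true) ∷_) m₃
  ...       | ys , m₄ , refl = AfterOverlined-∷ P Q true n ys (inj₁ le) sle (afterOverlined-sound f Q (n ∸ suc Q) ys m₄)
  largestAtMost-sound f n (suc Q) P xs le m | inj₂ m₂ | yes sle | inj₂ m₃ with ∈-map⁻ ((suc Q , false) ∷_) m₃
  ...       | ys , m₄ , refl = AfterOverlined-∷ P Q false n ys (inj₁ le) sle (afterOverlined-sound f Q (n ∸ suc Q) ys m₄)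

  ∈-prependBoth : ∀ Q n b ys L → suc Q ≤ n → ys ∈ L → ((suc Q , b) ∷ ys) ∈ prependBoth {Q} {n} (suc Q ≤? n) L
  ∈-prependBoth Q n b ys L le m with suc Q ≤? n
  ∈-prependBoth Q n true ys L le m | yes _ = ∈-++⁺ˡ (∈-map⁺ ((suc Q , true) ∷_) m)
  ∈-prependBoth Q n false ys L le m | yes _ = ∈-++⁺ʳ (map ((suc Q , true) ∷_) L) (∈-map⁺ ((suc Q , false) ∷_) m)
  ... | no nle = ⊥-elim (nle le)

  ∈-prependPlain : ∀ P n ys L → suc P ≤ n → ys ∈ L → ((suc P , false) ∷ ys) ∈ prependPlain {P} {n} (suc P ≤? n) L
  ∈-prependPlain P n ys L le m with suc P ≤? n
  ... | yes _ = ∈-map⁺ ((suc P , false) ∷_) m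
  ... | no nle = ⊥-elim (nle le)

  ∈-largestAtMost : ∀ f n P Q xs → Q < P → xs ∈ prependBoth {Q} {n} (suc Q ≤? n) (afterOverlined f Q (n ∸ suc Q)) →
                    xs ∈ largestAtMost f n P
  ∈-largestAtMost f n (suc P) Q xs (s≤s q≤p) m with Q ℕ.≟ P
  ... | yes refl = ∈-++⁺ʳ (largestAtMost f n Q) m
  ... | no q≢p = ∈-++⁺ˡ (∈-largestAtMost f n P Q xs (ℕP.≤∧≢⇒< q≤p q≢p) m)

  afterOverlined-complete : ∀ f P n xs → n ≤ f → AfterOverlined P n xs → xs ∈ afterOverlined f P n
  afterOverlined-complete f P .0 [] le (a , l , refl) = here refl
  afterOverlined-complete f P n ((zero , b) ∷ ys) le ((() ∷ _) , _)
  afterOverlined-complete (suc f) P .(suc Q + sum (map proj₁ ys)) ((suc Q , b) ∷ ys) (s≤s le) ((_ ∷ a) , (st ∷ l) , refl) =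
    go st
    where
    n = suc Q + sum (map proj₁ ys)
    tail∈ : ys ∈ afterOverlined f Q (n ∸ suc Q)
    tail∈ = afterOverlined-complete f Q (n ∸ suc Q) ys (fuel-∸ n f Q (s≤s le))
              (a , Linked-reoverline ys l , sym (ℕP.m+n∸m≡n Q (sum (map proj₁ ys))))
    sle : suc Q ≤ n
    sle = s≤s (ℕP.m≤m+n Q _)
    go : OrdStep (suc P , true) (suc Q , b) → ((suc Q , b) ∷ ys) ∈ afterOverlined (suc f) P n
    go (inj₁ (s≤s q<p)) = ∈-++⁺ˡ (∈-largestAtMost f n P Q _ q<p (∈-prependBoth Q n b ys _ sle tail∈))
    go (inj₂ (refl , refl)) = ∈-++⁺ʳ (largestAtMost f n P) (∈-prependPlain P n ys _ sle tail∈)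

  prependBoth-head : ∀ {Q n} d L xs → xs ∈ prependBoth {Q} {n} d L →
                     Σ Bool λ b → Σ (List Part) λ ys → xs ≡ (suc Q , b) ∷ ys
  prependBoth-head {Q} (yes _) L xs m with ∈-++⁻ (map ((suc Q , true) ∷_) L) m
  ... | inj₁ m₁ with ∈-map⁻ ((suc Q , true) ∷_) m₁
  ...   | ys , _ , refl = true , ys , refl
  prependBoth-head {Q} (yes _) L xs m | inj₂ m₂ with ∈-map⁻ ((suc Q , false) ∷_) m₂
  ...   | ys , _ , refl = false , ys , refl

  prependPlain-head : ∀ {P n} d L xs → xs ∈ prependPlain {P} {n} d L → Σ (List Part) λ ys → xs ≡ (suc P , false) ∷ ys
  prependPlain-head {P} (yes _) L xs m with ∈-map⁻ ((suc P , false) ∷_) m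
  ... | ys , _ , refl = ys , refl

  largestAtMost-head : ∀ f n Q xs → xs ∈ largestAtMost f n Q →
                       Σ ℕ λ v → Σ Bool λ b → Σ (List Part) λ ys → (xs ≡ (v , b) ∷ ys) × v ≤ Q
  largestAtMost-head f n (suc Q) xs m with ∈-++⁻ (largestAtMost f n Q) m
  ... | inj₁ m₁ with largestAtMost-head f n Q xs m₁
  ...   | v , b , ys , e , le = v , b , ys , e , ℕP.m≤n⇒m≤1+n le
  largestAtMost-head f n (suc Q) xs m | inj₂ m₂ with prependBoth-head (suc Q ≤? n) _ xs m₂
  ...   | b , ys , e = suc Q , b , ys , e , ℕP.≤-refl

  prependBoth-unique : ∀ {Q n} d L → Unique L → Unique (prependBoth {Q} {n} d L)
  prependBoth-unique {Q} (yes _) L u = Unique.++⁺ (Unique.map⁺ ∷-injectiveʳ u) (Unique.map⁺ ∷-injectiveʳ u) disjoint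
    where
    disjoint : ∀ {v} → ¬ (v ∈ map ((suc Q , true) ∷_) L × v ∈ map ((suc Q , false) ∷_) L)
    disjoint (m₁ , m₂) with ∈-map⁻ ((suc Q , true) ∷_) m₁ | ∈-map⁻ ((suc Q , false) ∷_) m₂
    ... | _ , _ , refl | _ , _ , e with ∷-injectiveˡ e
    ... | ()
  prependBoth-unique (no _) L u = []

  prependPlain-unique : ∀ {P n} d L → Unique L → Unique (prependPlain {P} {n} d L)
  prependPlain-unique (yes _) L u = Unique.map⁺ ∷-injectiveʳ u
  prependPlain-unique (no _) L u = []

  afterOverlined-unique : ∀ f P n → Unique (afterOverlined f P n)
  largestAtMost-unique : ∀ f n Q → Unique (largestAtMost f n Q)

  afterOverlined-unique f P zero = All.[] ∷ []
  afterOverlined-unique zero P (suc n) = []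
  afterOverlined-unique (suc f) P (suc n) =
    Unique.++⁺ (largestAtMost-unique f (suc n) P)
      (prependPlain-unique (suc P ≤? suc n) _ (afterOverlined-unique f P (suc n ∸ suc P))) disjoint
    where
    disjoint : ∀ {v} → ¬ (v ∈ largestAtMost f (suc n) P ×
                          v ∈ prependPlain {P} {suc n} (suc P ≤? suc n) (afterOverlined f P (suc n ∸ suc P)))
    disjoint {v} (m₁ , m₂) with largestAtMost-head f (suc n) P v m₁ | prependPlain-head (suc P ≤? suc n) _ v m₂
    ... | w , b , ys , refl , le | zs , e with ∷-injectiveˡ e
    ... | refl = ℕP.<-irrefl refl le

  largestAtMost-unique f n zero = []
  largestAtMost-unique f n (suc Q) =
    Unique.++⁺ (largestAtMost-unique f n Q) (prependBoth-unique (suc Q ≤? n) _ (afterOverlined-unique f Q (n ∸ suc Q))) disjoint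
    where
    disjoint : ∀ {v} → ¬ (v ∈ largestAtMost f n Q × v ∈ prependBoth {Q} {n} (suc Q ≤? n) (afterOverlined f Q (n ∸ suc Q)))
    disjoint {v} (m₁ , m₂) with largestAtMost-head f n Q v m₁ | prependBoth-head (suc Q ≤? n) _ v m₂
    ... | w , b , ys , refl , le | b' , zs , e with ∷-injectiveˡ e
    ... | refl = ℕP.<-irrefl refl le

  OrdStep-irrelevant : ∀ x y (p q : OrdStep x y) → p ≡ q
  OrdStep-irrelevant (p , x) (q , y) (inj₁ a) (inj₁ b) = cong inj₁ (ℕP.<-irrelevant a b)
  OrdStep-irrelevant (p , x) (q , y) (inj₁ a) (inj₂ (refl , _)) = ⊥-elim (ℕP.<-irrefl refl a)
  OrdStep-irrelevant (p , x) (q , y) (inj₂ (refl , _)) (inj₁ b) = ⊥-elim (ℕP.<-irrefl refl b)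
  OrdStep-irrelevant (p , x) (q , y) (inj₂ (e₁ , f₁)) (inj₂ (e₂ , f₂)) =
    cong₂ (λ a b → inj₂ (a , b)) (ℕP.≡-irrelevant e₁ e₂) (Decidable⇒UIP.≡-irrelevant BoolP._≟_ f₁ f₂)

  IsOverpartition-irrelevant : ∀ n xs (p q : IsOverpartition n xs) → p ≡ q
  IsOverpartition-irrelevant n xs (a , l , s) (a' , l' , s') =
    cong₂ _,_ (All.irrelevant ℕP.≤-irrelevant a a')
              (cong₂ _,_ (Linked.irrelevant (λ {x} {y} → OrdStep-irrelevant x y) l l') (ℕP.≡-irrelevant s s'))

  Linked-overlined-head : ∀ n xs → Linked OrdStep xs → sum (map proj₁ xs) ≡ n → Linked OrdStep ((suc n , true) ∷ xs)
  Linked-overlined-head n [] l s = [-]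
  Linked-overlined-head .(v + sum (map proj₁ ys)) ((v , b) ∷ ys) l refl = inj₁ (s≤s (ℕP.m≤m+n v _)) ∷ l

  -- A part suc n exceeds every part of an overpartition of n, so nothing is excluded at P = n.
  ∈-overpartitions⇔ : ∀ n xs → (xs ∈ afterOverlined n n n) ⇔ IsOverpartition n xs
  ∈-overpartitions⇔ n xs = mk⇔ to from
    where
    to : xs ∈ afterOverlined n n n → IsOverpartition n xs
    to m with afterOverlined-sound n n n xs m
    ... | a , l , s = a , Linked.tail l , s
    from : IsOverpartition n xs → xs ∈ afterOverlined n n n
    from (a , l , s) = afterOverlined-complete n n n xs ℕP.≤-refl (a , Linked-overlined-head n xs l s , s)

  countAfterOverlined : ℕ → ℕ → ℕ
  countAfterOverlined P n = length (afterOverlined n P n)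

  overpartitions↔ : ∀ n → Fin (countAfterOverlined n n) ↔ Overpartition n
  overpartitions↔ n = enumeration (IsOverpartition n) (afterOverlined n n n) (afterOverlined-unique n n n)
                                  (∈-overpartitions⇔ n) (IsOverpartition-irrelevant n)

module OverpartitionSeries where

  open import Data.Nat as ℕ using (ℕ; zero; suc; _≤?_; _∸_; _+_; _≤_; s≤s)
  import Data.Nat.Properties as ℕP
  open import Data.Integer as ℤ using (ℤ; +_; 0ℤ; 1ℤ)
  import Data.Integer.Properties as ℤP
  import Data.Integer.Tactic.RingSolver as ℤSolver
  open import Data.Bool using (true)
  open import Data.Product using (_,_)
  open import Data.List using (_∷_; map; length)
  open import Data.List.Properties using (length-++; length-map)
  open import Relation.Nullary using (yes; no)
  open import Relation.Binary.PropositionalEquality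
  open FormalPowerSeries
  open GaussIdentity using (overpartitionProduct)
  open Enumeration using (fuel-∸)
  open Overpartitions

  countSeries : ℕ → Series
  countSeries P n = + countAfterOverlined P n

  shiftedCount : ℕ → ℕ → ℤ
  shiftedCount P = shift (suc P) (countSeries P)

  length-prependPlain : ∀ n P →
    + length (prependPlain {P} {suc n} (suc P ≤? suc n) (afterOverlined n P (suc n ∸ suc P))) ≡ shiftedCount P (suc n)
  length-prependPlain n P with suc P ≤? suc n
  ... | yes (s≤s P≤n) =
    trans (cong +_ (trans (length-map _ (afterOverlined n P (n ∸ P)))
                          (cong length (afterOverlined-fuel n (n ∸ P) P (n ∸ P) (ℕP.m∸n≤m n P) ℕP.≤-refl))))
          (sym (shift-above P (countSeries P) n P≤n))
  ... | no P≰n = sym (shift-below (suc P) (countSeries P) (suc n) (ℕP.≰⇒> P≰n))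

  length-prependBoth : ∀ f n Q → n ≤ suc f →
    + length (prependBoth {Q} {n} (suc Q ≤? n) (afterOverlined f Q (n ∸ suc Q))) ≡ + 2 ℤ.* shiftedCount Q n
  length-prependBoth f n Q n≤f with suc Q ≤? n
  ... | yes Q<n =
    trans (cong +_ (trans (length-++ (map ((suc Q , true) ∷_) L))
                          (cong₂ ℕ._+_ (trans (length-map _ L) length-L) (trans (length-map _ L) length-L))))
          (trans (sym (ℤP.pos-+ c c)) (trans (cong₂ ℤ._+_ (sym count) (sym count)) (sym (double (shiftedCount Q n)))))
    where
    L = afterOverlined f Q (n ∸ suc Q)
    c = countAfterOverlined Q (n ∸ suc Q)
    length-L : length L ≡ c
    length-L = cong length (afterOverlined-fuel f (n ∸ suc Q) Q (n ∸ suc Q) (fuel-∸ n f Q n≤f) ℕP.≤-refl)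
    count : shiftedCount Q n ≡ + c
    count = shift-above (suc Q) (countSeries Q) n Q<n
    double : ∀ x → + 2 ℤ.* x ≡ x ℤ.+ x
    double = ℤSolver.solve-∀
  ... | no Q≮n = sym (trans (cong (λ z → + 2 ℤ.* z) (shift-below (suc Q) (countSeries Q) n (ℕP.≰⇒> Q≮n))) (ℤP.*-zeroʳ (+ 2)))

  countLargestAtMost : ℕ → ℕ → ℕ
  countLargestAtMost n Q = length (largestAtMost n (suc n) Q)

  countSeries-suc : ∀ n P → countSeries P (suc n) ≡ + countLargestAtMost n P ℤ.+ shiftedCount P (suc n)
  countSeries-suc n P = trans (cong +_ (length-++ (largestAtMost n (suc n) P)))
    (trans (ℤP.pos-+ (countLargestAtMost n P) _) (cong (λ z → + countLargestAtMost n P ℤ.+ z) (length-prependPlain n P)))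

  countLargestAtMost-suc : ∀ n Q → + countLargestAtMost n (suc Q) ≡ + countLargestAtMost n Q ℤ.+ + 2 ℤ.* shiftedCount Q (suc n)
  countLargestAtMost-suc n Q = trans (cong +_ (length-++ (largestAtMost n (suc n) Q)))
    (trans (ℤP.pos-+ (countLargestAtMost n Q) _)
           (cong (λ z → + countLargestAtMost n Q ℤ.+ z) (length-prependBoth n (suc n) Q ℕP.≤-refl)))

  countSeries-step : ∀ P n → countSeries (suc P) n ℤ.- shiftedCount (suc P) n ≡ countSeries P n ℤ.+ shiftedCount P n
  countSeries-step P zero = refl
  countSeries-step P (suc n) = begin
      countSeries (suc P) (suc n) ℤ.- shiftedCount (suc P) (suc n)
    ≡⟨ cong (ℤ._- shiftedCount (suc P) (suc n))
            (trans (countSeries-suc n (suc P)) (cong (ℤ._+ shiftedCount (suc P) (suc n)) (countLargestAtMost-suc n P))) ⟩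
      (+ countLargestAtMost n P ℤ.+ + 2 ℤ.* shiftedCount P (suc n) ℤ.+ shiftedCount (suc P) (suc n)) ℤ.- shiftedCount (suc P) (suc n)
    ≡⟨ cancel (+ countLargestAtMost n P) (shiftedCount (suc P) (suc n)) (shiftedCount P (suc n)) ⟩
      (+ countLargestAtMost n P ℤ.+ shiftedCount P (suc n)) ℤ.+ shiftedCount P (suc n)
    ≡⟨ cong (λ z → z ℤ.+ shiftedCount P (suc n)) (sym (countSeries-suc n P)) ⟩
      countSeries P (suc n) ℤ.+ shiftedCount P (suc n)
    ∎
    where
    open ≡-Reasoning
    cancel : ∀ a b c → (a ℤ.+ + 2 ℤ.* c ℤ.+ b) ℤ.- b ≡ (a ℤ.+ c) ℤ.+ c
    cancel = ℤSolver.solve-∀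

  countSeries-step₀ : ∀ n → countSeries 0 n ℤ.- shiftedCount 0 n ≡ 1ₛ n
  countSeries-step₀ zero = sym (constₛ-coeff-zero 1ℤ)
  countSeries-step₀ (suc n) =
    trans (cong (λ z → z ℤ.- shiftedCount 0 (suc n)) (countSeries-suc n 0))
      (trans (cancel (shiftedCount 0 (suc n))) (sym (constₛ-coeff-suc 1ℤ n)))
    where
    cancel : ∀ c → (+ 0 ℤ.+ c) ℤ.- c ≡ 0ℤ
    cancel = ℤSolver.solve-∀

  countSeries-recurrence : ∀ P → 1-q^ suc (suc P) *ₛ countSeries (suc P) ≈ 1+q^ suc P *ₛ countSeries P
  countSeries-recurrence P = mk≈ λ n →
    trans (1-q^-*-coeff (suc (suc P)) (countSeries (suc P)) n)
      (trans (countSeries-step P n) (sym (1+q^-*-coeff (suc P) (countSeries P) n)))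

  countSeries-recurrence₀ : 1-q^ 1 *ₛ countSeries 0 ≈ 1ₛ
  countSeries-recurrence₀ = mk≈ λ n → trans (1-q^-*-coeff 1 (countSeries 0) n) (countSeries-step₀ n)

  countSeries-closedForm : ∀ P → countSeries P ≈ overpartitionProduct P *ₛ geometric (suc P)
  countSeries-closedForm zero = ≈-trans (geometric-solves 0 countSeries-recurrence₀) (*-comm _ _)
  countSeries-closedForm (suc P) = ≈-trans (geometric-solves (suc P) (countSeries-recurrence P))
    (≈-trans (*-cong ≈-refl (*-cong ≈-refl (countSeries-closedForm P)))
      (solve 4 (λ g o G g₁ → g :* (o :* (G :* g₁)) := G :* (o :* g₁) :* g) ≈-refl
         (geometric (suc (suc P))) (1+q^ suc P) (overpartitionProduct P) (geometric (suc P))))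

  overpartitionProduct-stable : ∀ n j → overpartitionProduct (j + n) ≈[ suc n ] overpartitionProduct n
  overpartitionProduct-stable n zero = λ _ _ → refl
  overpartitionProduct-stable n (suc j) =
    ≈[]-trans (*-≈[] (overpartitionProduct-stable n j)
                     (*-≈[]1 (≈[]-weaken (s≤s (ℕP.m≤n+m n j)) (1+q^-≈[]1 (suc (j + n))))
                             (≈[]-weaken (s≤s (ℕP.m≤n+m n j)) (geometric-≈[]1 (j + n)))))
              (≈⇒≈[] (≈-trans (*-comm _ _) (*-identityˡ _)))

  overpartitionProduct-coeff : ∀ m n → n ≤ m → overpartitionProduct (m + m) n ≡ + countAfterOverlined n n
  overpartitionProduct-coeff m n n≤m =
    trans (cong (λ i → overpartitionProduct i n) (sym (ℕP.m∸n+n≡m n≤m+m)))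
      (trans (overpartitionProduct-stable n (m + m ∸ n) n ℕP.≤-refl)
        (sym (trans (coeff (countSeries-closedForm n) n)
          (trans (*-≈[] {f = overpartitionProduct n} (λ _ _ → refl) (geometric-≈[]1 n) n ℕP.≤-refl)
                 (coeff (≈-trans (*-comm _ _) (*-identityˡ _)) n)))))
    where
    n≤m+m : n ≤ m + m
    n≤m+m = ℕP.≤-trans n≤m (ℕP.m≤m+n m m)

module SquareCompositions where

  open import Defs
  open import Data.Nat as ℕ using (ℕ; zero; suc; _≤?_; _∸_; _+_; _*_; _<_; _≤_; s≤s; z≤n)
  import Data.Nat.Properties as ℕP
  open import Data.Product using (Σ; _×_; _,_)
  open import Data.Sum using (inj₁; inj₂)
  open import Data.List using (List; []; _∷_; map; _++_)
  open import Data.List.Properties using (∷-injectiveʳ; ∷-injectiveˡ)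
  open import Data.Nat.ListAction using (sum)
  open import Data.List.Relation.Unary.All using (_∷_)
  import Data.List.Relation.Unary.All as All
  open import Data.List.Membership.Propositional using (_∈_)
  open import Data.List.Membership.Propositional.Properties using (∈-map⁺; ∈-map⁻; ∈-++⁺ˡ; ∈-++⁺ʳ; ∈-++⁻)
  open import Data.List.Relation.Unary.Any using (here)
  open import Data.List.Relation.Unary.Unique.Propositional using (Unique)
  import Data.List.Relation.Unary.Unique.Propositional.Properties as Unique
  open import Data.List.Relation.Unary.AllPairs using ([]; _∷_)
  open import Function.Bundles using (mk⇔)
  open import Relation.Nullary using (yes; no; Dec; ¬_)
  open import Relation.Binary.PropositionalEquality
  open import Data.Empty using (⊥-elim)
  open Enumeration using (fuel-∸)

  prependSquare : ∀ {k n : ℕ} → Dec (k * k ≤ n) → List (List ℕ) → List (List ℕ)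
  prependSquare {k} (yes _) L = map ((k * k) ∷_) L
  prependSquare (no _) L = []

  -- squareComps f n lists the compositions of n into positive squares (for n ≤ f);
  -- firstSquareBelow f n K those of them whose first part is (suc k)² with k < K.
  squareComps : ℕ → ℕ → List (List ℕ)
  firstSquareBelow : ℕ → ℕ → ℕ → List (List ℕ)

  squareComps f zero = [] ∷ []
  squareComps zero (suc n) = []
  squareComps (suc f) (suc n) = firstSquareBelow f (suc n) (suc n)

  firstSquareBelow f n zero = []
  firstSquareBelow f n (suc k) =
    firstSquareBelow f n k ++ prependSquare {suc k} {n} (suc k * suc k ≤? n) (squareComps f (n ∸ suc k * suc k))

  squareCompositions : ℕ → List (List ℕ)
  squareCompositions n = squareComps n n

  squareComps-fuel : ∀ f f' n → n ≤ f → n ≤ f' → squareComps f n ≡ squareComps f' n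
  firstSquareBelow-fuel : ∀ f f' n K → n ≤ suc f → n ≤ suc f' → firstSquareBelow f n K ≡ firstSquareBelow f' n K

  squareComps-fuel f f' zero _ _ = refl
  squareComps-fuel (suc f) (suc f') (suc n) l l' = firstSquareBelow-fuel f f' (suc n) (suc n) l l'

  firstSquareBelow-fuel f f' n zero l l' = refl
  firstSquareBelow-fuel f f' n (suc k) l l' = cong₂ _++_ (firstSquareBelow-fuel f f' n k l l')
    (cong (prependSquare {suc k} {n} (suc k * suc k ≤? n))
          (squareComps-fuel f f' (n ∸ suc k * suc k) (fuel-∸ n f (k + k * suc k) l) (fuel-∸ n f' (k + k * suc k) l')))

  squareComps-sound : ∀ f n c → c ∈ squareComps f n → SqComp n c
  firstSquareBelow-sound : ∀ f n K c → c ∈ firstSquareBelow f n K → SqComp n c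

  squareComps-sound f zero .[] (here refl) = All.[] , refl
  squareComps-sound (suc f) (suc n) c m = firstSquareBelow-sound f (suc n) (suc n) c m

  firstSquareBelow-sound f n (suc k) c m with ∈-++⁻ (firstSquareBelow f n k) m
  ... | inj₁ m₁ = firstSquareBelow-sound f n k c m₁
  ... | inj₂ m₂ with suc k * suc k ≤? n
  ...   | yes le with ∈-map⁻ ((suc k * suc k) ∷_) m₂
  ...     | c' , m₃ , refl with squareComps-sound f (n ∸ suc k * suc k) c' m₃
  ...       | squares , s = ((suc k , s≤s z≤n , refl) ∷ squares) , trans (cong (suc k * suc k +_) s) (ℕP.m+[n∸m]≡n le)

  ∈-firstSquareBelow : ∀ f n K k c → k < K → suc k * suc k ≤ n → c ∈ squareComps f (n ∸ suc k * suc k) →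
                       ((suc k * suc k) ∷ c) ∈ firstSquareBelow f n K
  ∈-firstSquareBelow f n (suc K) k c (s≤s k≤K) le m with k ℕ.≟ K
  ... | yes refl = ∈-++⁺ʳ (firstSquareBelow f n k) (∈-prependSquare (suc k * suc k ≤? n))
    where
    ∈-prependSquare : (d : Dec (suc k * suc k ≤ n)) →
                      ((suc k * suc k) ∷ c) ∈ prependSquare {suc k} {n} d (squareComps f (n ∸ suc k * suc k))
    ∈-prependSquare (yes _) = ∈-map⁺ ((suc k * suc k) ∷_) m
    ∈-prependSquare (no nle) = ⊥-elim (nle le)
  ... | no k≢K = ∈-++⁺ˡ (∈-firstSquareBelow f n K k c (ℕP.≤∧≢⇒< k≤K k≢K) le m)

  squareComps-complete : ∀ f n c → n ≤ f → SqComp n c → c ∈ squareComps f n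
  squareComps-complete f .0 [] le (_ , refl) = here refl
  squareComps-complete f n (s ∷ c) le (((zero , () , _) ∷ _) , _)
  squareComps-complete (suc f) .(suc k * suc k + sum c) (.(suc k * suc k) ∷ c) (s≤s le) (((suc k , _ , refl) ∷ squares) , refl) =
    ∈-firstSquareBelow f N N k c (ℕP.≤-trans (ℕP.m≤m*n (suc k) (suc k)) (ℕP.m≤m+n (suc k * suc k) (sum c)))
      (ℕP.m≤m+n (suc k * suc k) (sum c))
      (squareComps-complete f (N ∸ suc k * suc k) c (fuel-∸ N f (k + k * suc k) (s≤s le))
                            (squares , sym (ℕP.m+n∸m≡n (suc k * suc k) (sum c))))
    where N = suc k * suc k + sum c

  firstSquareBelow-head : ∀ f n K c → c ∈ firstSquareBelow f n K →
                          Σ ℕ λ k → Σ (List ℕ) λ c' → (c ≡ (suc k * suc k) ∷ c') × k < K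
  firstSquareBelow-head f n (suc K) c m with ∈-++⁻ (firstSquareBelow f n K) m
  ... | inj₁ m₁ with firstSquareBelow-head f n K c m₁
  ...   | k , c' , e , lt = k , c' , e , ℕP.m≤n⇒m≤1+n lt
  firstSquareBelow-head f n (suc K) c m | inj₂ m₂ with suc K * suc K ≤? n
  ...   | yes _ with ∈-map⁻ ((suc K * suc K) ∷_) m₂
  ...     | c' , _ , refl = K , c' , refl , ℕP.≤-refl

  prependSquare-unique : ∀ {k n} d L → Unique L → Unique (prependSquare {k} {n} d L)
  prependSquare-unique (yes _) L u = Unique.map⁺ ∷-injectiveʳ u
  prependSquare-unique (no _) L u = []

  squareComps-unique : ∀ f n → Unique (squareComps f n)
  firstSquareBelow-unique : ∀ f n K → Unique (firstSquareBelow f n K)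

  squareComps-unique f zero = All.[] ∷ []
  squareComps-unique zero (suc n) = []
  squareComps-unique (suc f) (suc n) = firstSquareBelow-unique f (suc n) (suc n)

  firstSquareBelow-unique f n zero = []
  firstSquareBelow-unique f n (suc K) =
    Unique.++⁺ (firstSquareBelow-unique f n K)
      (prependSquare-unique {suc K} {n} (suc K * suc K ≤? n) _ (squareComps-unique f (n ∸ suc K * suc K))) disjoint
    where
    disjoint : ∀ {v} → ¬ (v ∈ firstSquareBelow f n K ×
                          v ∈ prependSquare {suc K} {n} (suc K * suc K ≤? n) (squareComps f (n ∸ suc K * suc K)))
    disjoint {v} (m₁ , m₂) with firstSquareBelow-head f n K v m₁
    ... | k , c' , refl , k<K = notIn (suc K * suc K ≤? n) m₂
      where
      notIn : (d : Dec (suc K * suc K ≤ n)) →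
              ¬ (((suc k * suc k) ∷ c') ∈ prependSquare {suc K} {n} d (squareComps f (n ∸ suc K * suc K)))
      notIn (yes _) m with ∈-map⁻ ((suc K * suc K) ∷_) m
      ... | _ , _ , e = ℕP.<-irrefl (∷-injectiveˡ e) (ℕP.*-mono-< (s≤s k<K) (s≤s k<K))

  squareCompositions-enumerates : ∀ n → EnumSqComp n (squareCompositions n)
  squareCompositions-enumerates n =
    squareComps-unique n n , λ c → mk⇔ (squareComps-sound n n c) (squareComps-complete n n c ℕP.≤-refl)

module GaussRecurrence where

  open import Data.Nat using (ℕ; zero; suc; _≤?_; _∸_; _*_; _<_; _≤_; s≤s; z≤n)
  import Data.Nat.Properties as ℕP
  open import Data.Nat.Induction using (<-rec)
  open import Data.Integer as ℤ using (ℤ; 0ℤ; 1ℤ)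
  import Data.Integer.Properties as ℤP
  open import Algebra.Bundles using (AbelianGroup)
  open import Algebra.Properties.Group (AbelianGroup.group ℤP.+-0-abelianGroup) using (∙-cancelʳ)
  open import Data.Product using (_×_; _,_)
  open import Relation.Nullary using (yes; no; Dec)
  open import Relation.Binary.PropositionalEquality
  open import Data.Empty using (⊥-elim)
  open TripleProduct using (foldedSign)
  open GaussIdentity using (foldedSumℤ)

  whenSquareFits : ∀ {k n : ℕ} → Dec (k * k ≤ n) → ℤ → ℤ
  whenSquareFits (yes _) x = x
  whenSquareFits (no _) x = 0ℤ

  squareTerm : (ℕ → ℤ) → ℕ → ℕ → ℤ
  squareTerm x n k = whenSquareFits {k} {n} (k * k ≤? n) (x (n ∸ k * k))

  squareTerm-zero : ∀ x n → squareTerm x n 0 ≡ x n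
  squareTerm-zero x n with 0 ≤? n
  ... | yes _ = refl
  ... | no 0≰n = ⊥-elim (0≰n z≤n)

  foldedTail : (ℕ → ℤ) → ℕ → ℤ
  foldedTail f zero = 0ℤ
  foldedTail f (suc L) = foldedTail f L ℤ.+ foldedSign (suc L) ℤ.* f (suc L)

  foldedSumℤ-tail : ∀ f L → foldedSumℤ f L ≡ f 0 ℤ.+ foldedTail f L
  foldedSumℤ-tail f zero = sym (ℤP.+-identityʳ (f 0))
  foldedSumℤ-tail f (suc L) =
    trans (cong (λ z → z ℤ.+ foldedSign (suc L) ℤ.* f (suc L)) (foldedSumℤ-tail f L)) (ℤP.+-assoc (f 0) (foldedTail f L) _)

  -- The recurrence ∑_{k ∈ ℤ, k² ≤ n} (-1)^k x (n - k²) = [n = 0] expressed by Gauss's identity.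
  SatisfiesGauss : (ℕ → ℤ) → Set
  SatisfiesGauss x = x 0 ≡ 1ℤ × (∀ n → x (suc n) ℤ.+ foldedTail (squareTerm x (suc n)) (suc n) ≡ 0ℤ)

  foldedTail-squareTerm-cong : ∀ {x y} n L → (∀ j → j < suc n → x j ≡ y j) →
                               foldedTail (squareTerm x (suc n)) L ≡ foldedTail (squareTerm y (suc n)) L
  foldedTail-squareTerm-cong n zero x≡y = refl
  foldedTail-squareTerm-cong {x} {y} n (suc L) x≡y =
    cong₂ ℤ._+_ (foldedTail-squareTerm-cong n L x≡y)
                (cong (foldedSign (suc L) ℤ.*_) (term (suc L * suc L ≤? suc n)))
    where
    term : (d : Dec (suc L * suc L ≤ suc n)) →
           whenSquareFits {suc L} {suc n} d (x (suc n ∸ suc L * suc L))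
             ≡ whenSquareFits {suc L} {suc n} d (y (suc n ∸ suc L * suc L))
    term (yes le) = x≡y _ (ℕP.∸-monoʳ-< {o = 0} (s≤s z≤n) le)
    term (no _) = refl

  SatisfiesGauss-unique : ∀ {x y} → SatisfiesGauss x → SatisfiesGauss y → ∀ n → x n ≡ y n
  SatisfiesGauss-unique {x} {y} (x₀ , x-step) (y₀ , y-step) = <-rec _ agree
    where
    agree : ∀ n → (∀ {j} → j < n → x j ≡ y j) → x n ≡ y n
    agree zero _ = trans x₀ (sym y₀)
    agree (suc n) ih = ∙-cancelʳ (foldedTail (squareTerm y (suc n)) (suc n)) (x (suc n)) (y (suc n))
      (trans (cong (λ t → x (suc n) ℤ.+ t) (sym (foldedTail-squareTerm-cong n (suc n) (λ _ → ih))))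
             (trans (x-step n) (sym (y-step n))))

module OverpartitionRecurrence where

  open import Data.Nat using (ℕ; suc; _≤?_; _∸_; _+_; _*_; _≤_)
  import Data.Nat.Properties as ℕP
  open import Data.Integer as ℤ using (ℤ; +_; 1ℤ)
  open import Data.Product using (_,_)
  open import Relation.Nullary using (yes; no; Dec)
  open import Relation.Binary.PropositionalEquality
  open FormalPowerSeries
  open GaussIdentity using (overpartitionProduct; foldedSumℤ; foldedSumℤ-cong; gauss-coeff)
  open Overpartitions using (countAfterOverlined)
  open OverpartitionSeries using (overpartitionProduct-coeff)
  open GaussRecurrence

  overpartitionCount : ℕ → ℤ
  overpartitionCount n = + countAfterOverlined n n

  squareTerm-overpartitionCount : ∀ n k → (q^ (k * k) *ₛ overpartitionProduct (n + n)) n ≡ squareTerm overpartitionCount n k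
  squareTerm-overpartitionCount n k = trans (coeff (q^-*-shift (k * k) _) n) (fits (k * k ≤? n))
    where
    fits : (d : Dec (k * k ≤ n)) →
           shift (k * k) (overpartitionProduct (n + n)) n ≡ whenSquareFits {k} {n} d (overpartitionCount (n ∸ k * k))
    fits (yes le) = trans (shift-above (k * k) _ n le) (overpartitionProduct-coeff n (n ∸ k * k) (ℕP.m∸n≤m n (k * k)))
    fits (no nle) = shift-below (k * k) _ n (ℕP.≰⇒> nle)

  overpartitionCount-foldedSum : ∀ n → foldedSumℤ (squareTerm overpartitionCount n) n ≡ 1ₛ n
  overpartitionCount-foldedSum n =
    trans (sym (foldedSumℤ-cong _ _ n (λ k _ → squareTerm-overpartitionCount n k))) (gauss-coeff n)

  overpartitionCount-satisfiesGauss : SatisfiesGauss overpartitionCount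
  overpartitionCount-satisfiesGauss =
    trans (sym (squareTerm-zero overpartitionCount 0)) (trans (overpartitionCount-foldedSum 0) (constₛ-coeff-zero 1ℤ)) ,
    λ n → trans (cong (λ z → z ℤ.+ foldedTail (squareTerm overpartitionCount (suc n)) (suc n))
                      (sym (squareTerm-zero overpartitionCount (suc n))))
            (trans (sym (foldedSumℤ-tail (squareTerm overpartitionCount (suc n)) (suc n)))
                   (trans (overpartitionCount-foldedSum (suc n)) (constₛ-coeff-suc 1ℤ n)))

module SquareCompositionWeights where

  open import Defs
  open import Data.Nat using (ℕ; zero; suc; _≤?_; _∸_; _+_; _*_; _≤_)
  import Data.Nat.Properties as ℕP
  open import Data.Integer as ℤ using (ℤ; +_; 0ℤ; 1ℤ; -[1+_])
  import Data.Integer.Properties as ℤP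
  import Data.Integer.Tactic.RingSolver as ℤSolver
  open import Data.Product using (_,_)
  open import Data.Sum using (_⊎_; inj₁; inj₂)
  open import Data.List using (List; []; _∷_; map; _++_)
  open import Data.List.Properties using (map-++)
  open import Relation.Nullary using (yes; no; Dec)
  open import Relation.Binary.PropositionalEquality
  open TripleProduct using (foldedSign)
  open Enumeration using (fuel-∸)
  open SquareCompositions
  open GaussRecurrence

  totalWeight : List (List ℕ) → ℤ
  totalWeight L = sumℤ (map weight L)

  sumℤ-++ : ∀ xs ys → sumℤ (xs ++ ys) ≡ sumℤ xs ℤ.+ sumℤ ys
  sumℤ-++ [] ys = sym (ℤP.+-identityˡ _)
  sumℤ-++ (x ∷ xs) ys = trans (cong (λ z → x ℤ.+ z) (sumℤ-++ xs ys)) (sym (ℤP.+-assoc x (sumℤ xs) (sumℤ ys)))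

  totalWeight-++ : ∀ L L' → totalWeight (L ++ L') ≡ totalWeight L ℤ.+ totalWeight L'
  totalWeight-++ L L' = trans (cong sumℤ (map-++ weight L L')) (sumℤ-++ (map weight L) (map weight L'))

  totalWeight-prepend : ∀ s L → totalWeight (map (s ∷_) L) ≡ -[1+ 1 ] ℤ.* totalWeight L
  totalWeight-prepend s [] = refl
  totalWeight-prepend s (c ∷ L) =
    trans (cong (λ z → -[1+ 1 ] ℤ.* weight c ℤ.+ z) (totalWeight-prepend s L))
          (sym (ℤP.*-distribˡ-+ -[1+ 1 ] (weight c) (totalWeight L)))

  compositionWeight : ℕ → ℤ
  compositionWeight n = totalWeight (squareCompositions n)

  squareSum : (ℕ → ℤ) → ℕ → ℕ → ℤ
  squareSum x n zero = 0ℤ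
  squareSum x n (suc k) = squareSum x n k ℤ.+ squareTerm x n (suc k)

  totalWeight-firstSquareBelow : ∀ f n K → n ≤ suc f →
    totalWeight (firstSquareBelow f n K) ≡ -[1+ 1 ] ℤ.* squareSum compositionWeight n K
  totalWeight-firstSquareBelow f n zero l = refl
  totalWeight-firstSquareBelow f n (suc k) l =
    trans (totalWeight-++ (firstSquareBelow f n k) _)
      (trans (cong₂ ℤ._+_ (totalWeight-firstSquareBelow f n k l) (prepended (suc k * suc k ≤? n)))
             (sym (ℤP.*-distribˡ-+ -[1+ 1 ] (squareSum compositionWeight n k) _)))
    where
    prepended : (d : Dec (suc k * suc k ≤ n)) →
      totalWeight (prependSquare {suc k} {n} d (squareComps f (n ∸ suc k * suc k)))
        ≡ -[1+ 1 ] ℤ.* whenSquareFits {suc k} {n} d (compositionWeight (n ∸ suc k * suc k))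
    prepended (yes _) = trans (totalWeight-prepend (suc k * suc k) (squareComps f (n ∸ suc k * suc k)))
      (cong (λ L → -[1+ 1 ] ℤ.* totalWeight L)
            (squareComps-fuel f (n ∸ suc k * suc k) (n ∸ suc k * suc k) (fuel-∸ n f (k + k * suc k) l) ℕP.≤-refl))
    prepended (no _) = refl

  compositionWeight-suc : ∀ n → compositionWeight (suc n) ≡ -[1+ 1 ] ℤ.* squareSum compositionWeight (suc n) (suc n)
  compositionWeight-suc n = totalWeight-firstSquareBelow n (suc n) (suc n) ℕP.≤-refl

  -1ℤ : ℤ
  -1ℤ = ℤ.- (+ 1)

  signedWeight : ℕ → ℤ
  signedWeight n = -1ℤ ℤ.^ n ℤ.* compositionWeight n

  foldedSign-suc : ∀ L → foldedSign (suc L) ≡ + 2 ℤ.* -1ℤ ℤ.^ suc L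
  foldedSign-suc zero = refl
  foldedSign-suc (suc L) = trans (cong ℤ.-_ (foldedSign-suc L)) (negate (-1ℤ ℤ.^ suc L))
    where
    negate : ∀ y → ℤ.- (+ 2 ℤ.* y) ≡ + 2 ℤ.* (ℤ.- (+ 1) ℤ.* y)
    negate = ℤSolver.solve-∀

  -1^-square : ∀ k → -1ℤ ℤ.^ (k * k) ≡ -1ℤ ℤ.^ k
  -1^-square k = trans (sym (ℤP.^-*-assoc -1ℤ k k)) (idempotent (±1 k))
    where
    ±1 : ∀ k → (-1ℤ ℤ.^ k ≡ 1ℤ) ⊎ (-1ℤ ℤ.^ k ≡ -1ℤ)
    ±1 zero = inj₁ refl
    ±1 (suc k) with ±1 k
    ... | inj₁ e = inj₂ (cong (-1ℤ ℤ.*_) e)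
    ... | inj₂ e = inj₁ (cong (-1ℤ ℤ.*_) e)
    idempotent : (-1ℤ ℤ.^ k ≡ 1ℤ) ⊎ (-1ℤ ℤ.^ k ≡ -1ℤ) → (-1ℤ ℤ.^ k) ℤ.^ k ≡ -1ℤ ℤ.^ k
    idempotent (inj₁ e) = trans (cong (ℤ._^ k) e) (trans (ℤP.^-zeroˡ k) (sym e))
    idempotent (inj₂ e) = cong (ℤ._^ k) e

  -- The signs (-1)^(n - k²) and 2 (-1)^k combine to 2 (-1)^n since k² ≡ k mod 2.
  foldedTail-signedWeight : ∀ n L →
    foldedTail (squareTerm signedWeight n) L ≡ (+ 2 ℤ.* -1ℤ ℤ.^ n) ℤ.* squareSum compositionWeight n L
  foldedTail-signedWeight n zero = sym (ℤP.*-zeroʳ (+ 2 ℤ.* -1ℤ ℤ.^ n))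
  foldedTail-signedWeight n (suc L) =
    trans (cong₂ ℤ._+_ (foldedTail-signedWeight n L) (term (suc L * suc L ≤? n)))
          (sym (ℤP.*-distribˡ-+ (+ 2 ℤ.* -1ℤ ℤ.^ n) (squareSum compositionWeight n L) _))
    where
    q = suc L * suc L
    term : (d : Dec (q ≤ n)) → foldedSign (suc L) ℤ.* whenSquareFits {suc L} {n} d (signedWeight (n ∸ q))
                              ≡ (+ 2 ℤ.* -1ℤ ℤ.^ n) ℤ.* whenSquareFits {suc L} {n} d (compositionWeight (n ∸ q))
    term (yes q≤n) = begin
        foldedSign (suc L) ℤ.* (-1ℤ ℤ.^ (n ∸ q) ℤ.* compositionWeight (n ∸ q))
      ≡⟨ cong (ℤ._* (-1ℤ ℤ.^ (n ∸ q) ℤ.* compositionWeight (n ∸ q)))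
              (trans (foldedSign-suc L) (cong (λ z → + 2 ℤ.* z) (sym (-1^-square (suc L))))) ⟩
        (+ 2 ℤ.* -1ℤ ℤ.^ q) ℤ.* (-1ℤ ℤ.^ (n ∸ q) ℤ.* compositionWeight (n ∸ q))
      ≡⟨ regroup (-1ℤ ℤ.^ q) (-1ℤ ℤ.^ (n ∸ q)) (compositionWeight (n ∸ q)) ⟩
        (+ 2 ℤ.* (-1ℤ ℤ.^ q ℤ.* -1ℤ ℤ.^ (n ∸ q))) ℤ.* compositionWeight (n ∸ q)
      ≡⟨ cong (λ z → (+ 2 ℤ.* z) ℤ.* compositionWeight (n ∸ q))
              (trans (sym (ℤP.^-distribˡ-+-* -1ℤ q (n ∸ q))) (cong (-1ℤ ℤ.^_) (ℕP.m+[n∸m]≡n q≤n))) ⟩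
        (+ 2 ℤ.* -1ℤ ℤ.^ n) ℤ.* compositionWeight (n ∸ q)
      ∎
      where
      open ≡-Reasoning
      regroup : ∀ x y w → (+ 2 ℤ.* x) ℤ.* (y ℤ.* w) ≡ (+ 2 ℤ.* (x ℤ.* y)) ℤ.* w
      regroup = ℤSolver.solve-∀
    term (no _) = trans (ℤP.*-zeroʳ (foldedSign (suc L))) (sym (ℤP.*-zeroʳ (+ 2 ℤ.* -1ℤ ℤ.^ n)))

  signedWeight-satisfiesGauss : SatisfiesGauss signedWeight
  signedWeight-satisfiesGauss = refl , λ n →
    trans (cong₂ ℤ._+_ (cong (λ z → -1ℤ ℤ.^ suc n ℤ.* z) (compositionWeight-suc n))
                       (foldedTail-signedWeight (suc n) (suc n)))
          (cancel (-1ℤ ℤ.^ suc n) (squareSum compositionWeight (suc n) (suc n)))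
    where
    cancel : ∀ s c → s ℤ.* (-[1+ 1 ] ℤ.* c) ℤ.+ (+ 2 ℤ.* s) ℤ.* c ≡ 0ℤ
    cancel = ℤSolver.solve-∀

open import Defs
open import Data.Nat using (ℕ)
open import Data.Fin using (Fin)
open import Data.Product using (Σ; _×_; _,_)
open import Data.List using (List; map)
open import Data.Integer using (+_; -_; _*_; _^_)
open import Function.Bundles using (_↔_)
open import Relation.Binary.PropositionalEquality using (_≡_)
open Overpartitions using (countAfterOverlined; overpartitions↔)
open SquareCompositions using (squareCompositions; squareCompositions-enumerates)
open GaussRecurrence using (SatisfiesGauss-unique)
open OverpartitionRecurrence using (overpartitionCount; overpartitionCount-satisfiesGauss)
open SquareCompositionWeights using (signedWeight; signedWeight-satisfiesGauss)

theorem1p6 : (n : ℕ) →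
    Σ ℕ λ k → (Fin k ↔ Overpartition n) ×
      (Σ (List (List ℕ)) λ cs → EnumSqComp n cs ×
        (+ k ≡ ((- (+ 1)) ^ n) * sumℤ (map weight cs)))
theorem1p6 n =
  countAfterOverlined n n , overpartitions↔ n ,
  squareCompositions n , squareCompositions-enumerates n ,
  SatisfiesGauss-unique {overpartitionCount} {signedWeight}
    overpartitionCount-satisfiesGauss signedWeight-satisfiesGauss n
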